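{- Let $n\ge1$, let $F$ be a $2$-regular graph of order $2n+1$, and let $r$ denote the number of cycles of $F$ of even length. Suppose $F$ satisfies: (1) $V(F)=\mathbb{Z}_{2n}\cup\{\infty\}$; (2) $\Delta F\supseteq \mathbb{Z}_{2n}\setminus\{0\}$; (3) $F+n=F$; and suppose the cycle of $F$ passing through $\infty$ has length $3$. Then either $n\equiv 0\pmod 4$ or $\frac{n-1}{2}+r$ is an even integer.
   Context: For a graph $\Gamma$ with vertices in $\mathbb{Z}_{2n}\cup\{\infty\}$, $\Delta\Gamma$ is the multiset of all differences $x-y\in\mathbb{Z}_{2n}$ over all ordered pairs $(x,y)$ of adjacent vertices of $\Gamma$ with $x,y\neq\infty$ (each such edge contributes both $x-y$ and $y-x$). For $g\in\mathbb{Z}_{2n}$, $\Gamma+g$ is the graph obtained from $\Gamma$ by replacing each vertex $x\neq\infty$ with $x+g$ (and fixing $\infty$). -}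

module Defs where

open import Data.Nat using (ℕ; zero; suc; _+_; _*_; _∸_; _≤_; _%_)
open import Data.Nat.DivMod using (m%n<n)
open import Relation.Binary.PropositionalEquality using (_≡_)
open import Data.Product using (_×_)
open import Data.Fin using (Fin; toℕ; fromℕ<)
open import Data.Fin.Properties using () renaming (_≟_ to _≟F_)
open import Data.Maybe using (Maybe; just; nothing)
open import Data.Maybe.Properties using (≡-dec)
open import Data.Bool using (Bool; true; false; _∧_; _∨_; not)
open import Data.List using (List; _∷_; []; map; filterᵇ; length; allFin)
open import Data.Bool.ListAction using (any; all)
open import Relation.Nullary.Decidable using (⌊_⌋)

-- Throughout, n = suc k (so n ≥ 1), and ℤ_{2n} is represented by Fin (2 * suc k).

Zn : ℕ → Set
Zn k = Fin (2 * suc k)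

modZ : (k : ℕ) → ℕ → Zn k
modZ k a = fromℕ< (m%n<n a (2 * suc k))

_⊖_ : {k : ℕ} → Zn k → Zn k → Zn k
_⊖_ {k} x y = modZ k (toℕ x + (2 * suc k ∸ toℕ y))

addZ : {k : ℕ} → Zn k → ℕ → Zn k
addZ {k} x g = modZ k (toℕ x + g)

-- vertex set ℤ_{2n} ∪ {∞}; nothing = ∞, just x = x ∈ ℤ_{2n}
Vtx : ℕ → Set
Vtx k = Maybe (Zn k)

∞ : {k : ℕ} → Vtx k
∞ = nothing

vertices : (k : ℕ) → List (Vtx k)
vertices k = nothing ∷ map just (allFin (2 * suc k))

_==_ : {k : ℕ} → Vtx k → Vtx k → Bool
_==_ x y = ⌊ ≡-dec _≟F_ x y ⌋

-- rank used to pick a canonical representative of each component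
rank : {k : ℕ} → Vtx k → ℕ
rank nothing = 0
rank (just x) = suc (toℕ x)

Graph : ℕ → Set
Graph k = Vtx k → Vtx k → Bool

IsSimple : {k : ℕ} → Graph k → Set
IsSimple {k} A = ((x y : Vtx k) → A x y ≡ A y x) × ((x : Vtx k) → A x x ≡ false)

degree : {k : ℕ} → Graph k → Vtx k → ℕ
degree {k} A v = length (filterᵇ (A v) (vertices k))

reach : {k : ℕ} → Graph k → ℕ → Vtx k → Vtx k → Bool
reach A zero u v = u == v
reach {k} A (suc s) u v = reach A s u v ∨ any (λ w → reach A s u w ∧ A w v) (vertices k)

-- connectedness (walks of length ≤ |V| = 2n+1 suffice)
connected : {k : ℕ} → Graph k → Vtx k → Vtx k → Bool
connected {k} A u v = reach A (suc (2 * suc k)) u v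

-- number of vertices of the connected component of v
-- (for a 2-regular graph: the length of the cycle through v)
compSize : {k : ℕ} → Graph k → Vtx k → ℕ
compSize {k} A v = length (filterᵇ (connected A v) (vertices k))

isRep : {k : ℕ} → Graph k → Vtx k → Bool
isRep {k} A v = all (λ w → not (connected A v w) ∨ ⌊ rank v Data.Nat.≤? rank w ⌋) (vertices k)
  where import Data.Nat

isEven : ℕ → Bool
isEven n = ⌊ n % 2 Data.Nat.≟ 0 ⌋
  where import Data.Nat

-- number of components (= cycles, for a 2-regular graph) of even length
evenCycles : {k : ℕ} → Graph k → ℕ
evenCycles {k} A = length (filterᵇ (λ v → isRep A v ∧ isEven (compSize A v)) (vertices k))

shiftV : {k : ℕ} → ℕ → Vtx k → Vtx k
shiftV g nothing = nothing
shiftV g (just x) = just (addZ x g)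

module Submission where

-- Let A be the number of ordered pairs (x, y) of adjacent finite vertices with x − y odd.
-- Since F + n = F, every difference occurs an even number of times, so the 2n − 1 edges
-- missing ∞ give each nonzero difference exactly twice. Hence A = 2n, and the only edge of
-- difference n is the edge {z, z + n} of the triangle through ∞.
-- Now count A cycle by cycle. Around a cycle the parity of the vertex changes an even number
-- of times, so a cycle avoiding ∞ contributes a multiple of 4. If C + n = C, the shift acts on
-- C as the rotation by half its length (a reflection would need another edge of difference n),
-- so C has even length and contributes 4(n mod 2) modulo 8. The remaining cycles come in pairs
-- C ≠ C + n with equal contributions, and the triangle contributes 2(n mod 2). So, with f the
-- number of cycles C = C + n, 2n ≡ 2(n mod 2) + 4(n mod 2) f (mod 8), while r ≡ f (mod 2):
-- for n even this gives 4 ∣ n, and for n odd (n − 1)/2 ≡ f ≡ r (mod 2).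

open import Defs
open import Data.Nat hiding (parity)
open import Data.Nat.Properties
open import Data.Nat.DivMod
open import Data.Nat.Divisibility using (divides; m∣m*n; m%n≡0⇒n∣m)
open import Data.Nat.Induction using (<-rec)
open import Data.Nat.Tactic.RingSolver using (solve-∀)
open import Data.Fin using (Fin; zero; suc; toℕ; fromℕ<; combine)
open import Data.Fin.Properties using (toℕ-injective; toℕ-fromℕ<; toℕ<n; pigeonhole; combine-injective)
  renaming (_≟_ to _≟ᶠ_)
open import Data.Fin.Permutation using (permutation)
open import Data.Maybe using (just; nothing)
open import Data.Maybe.Properties using (just-injective) renaming (≡-dec to ≡-dec-Maybe)
open import Data.Bool using (Bool; true; false; _∧_; _∨_; not)
open import Data.Bool.Properties using (T?; T-≡; ∨-zeroʳ; ∧-zeroʳ; ∧-identityʳ)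
open import Data.Bool.ListAction using (any; all)
open import Data.List using ([]; _∷_; map; length; filterᵇ; allFin; tabulate)
open import Data.List.Properties using (map-tabulate)
open import Data.List.Membership.Propositional using (_∈_)
open import Data.List.Membership.Propositional.Properties using (∈-filter⁺; ∈-filter⁻; ∈-map⁺; ∈-allFin)
open import Data.List.Relation.Unary.Any using (here; there)
open import Data.List.Relation.Unary.All using (All; []; _∷_)
open import Data.List.Relation.Unary.AllPairs using (_∷_)
open import Data.List.Relation.Unary.Unique.Propositional using (Unique)
import Data.List.Relation.Unary.Unique.Propositional.Properties as Unique
open import Data.Product using (_×_; _,_; ∃; ∃₂; proj₁; proj₂)
open import Data.Product.Properties using () renaming (≡-dec to ≡-dec-×)
open import Data.Sum using (_⊎_; inj₁; inj₂)
open import Data.Empty using (⊥; ⊥-elim)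
open import Relation.Nullary using (yes; no; ¬_; Dec; does)
open import Relation.Nullary.Decidable using (⌊_⌋)
open import Relation.Binary using (tri<; tri≈; tri>)
open import Relation.Binary.PropositionalEquality
open import Function using (_∘_; Equivalence)
open import Algebra.Properties.Semiring.Sum +-*-semiring
  using (sum; sum-cong-≗; ∑-distrib-+; ∑-comm; ∑-permute; *-distribˡ-sum; sum-replicate-zero)

infix 8 [_]·_

[_]·_ : Bool → ℕ → ℕ
[ true ]· x = x
[ false ]· x = 0

[]·-zeroʳ : ∀ b → [ b ]· 0 ≡ 0
[]·-zeroʳ true = refl
[]·-zeroʳ false = refl

[]·-≤ : ∀ b x → [ b ]· x ≤ x
[]·-≤ true x = ≤-refl
[]·-≤ false x = z≤n

[]·-∧ : ∀ a b x → [ a ∧ b ]· x ≡ [ a ]· [ b ]· x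
[]·-∧ true b x = refl
[]·-∧ false b x = refl

[]·-comm-* : ∀ b x → [ b ]· x ≡ x * [ b ]· 1
[]·-comm-* true x = sym (*-identityʳ x)
[]·-comm-* false x = sym (*-zeroʳ x)

[]·-multiple : ∀ b m x → (b ≡ true → ∃ λ t → x ≡ m * t) → ∃ λ t → [ b ]· x ≡ m * t
[]·-multiple false m x _ = 0 , sym (*-zeroʳ m)
[]·-multiple true m x x≡mt = x≡mt refl

-- With does rather than ⌊_⌋, suc i ≟ᵇ suc j reduces to i ≟ᵇ j.
_≟ᵇ_ : ∀ {m} → Fin m → Fin m → Bool
i ≟ᵇ j = does (i ≟ᶠ j)

≟ᵇ-refl : ∀ {m} (i : Fin m) → (i ≟ᵇ i) ≡ true
≟ᵇ-refl i with i ≟ᶠ i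
... | yes _ = refl
... | no i≢i = ⊥-elim (i≢i refl)

sum-const : ∀ m c → sum {m} (λ _ → c) ≡ m * c
sum-const zero c = refl
sum-const (suc m) c = cong (c +_) (sum-const m c)

sum-mono-≤ : ∀ {m} (f g : Fin m → ℕ) → (∀ i → f i ≤ g i) → sum f ≤ sum g
sum-mono-≤ {zero} f g f≤g = z≤n
sum-mono-≤ {suc m} f g f≤g = +-mono-≤ (f≤g zero) (sum-mono-≤ (f ∘ suc) (g ∘ suc) (f≤g ∘ suc))

sum-pick : ∀ {m} (j : Fin m) (g : Fin m → ℕ) → sum (λ i → [ j ≟ᵇ i ]· g i) ≡ g j
sum-pick {suc m} zero g = trans (cong (g zero +_) (trans (sum-const m 0) (*-zeroʳ m))) (+-identityʳ (g zero))
sum-pick {suc m} (suc j) g = sum-pick j (g ∘ suc)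

sum-point : ∀ {m} (f : Fin m → ℕ) (j : Fin m) → f j ≤ sum f
sum-point f j = subst (_≤ sum f) (sum-pick j f) (sum-mono-≤ _ f (λ i → []·-≤ (j ≟ᵇ i) (f i)))

sum-three : ∀ {m} (f : Fin m → ℕ) {i j l : Fin m} → i ≢ j → i ≢ l → j ≢ l →
            f i + f j + f l ≤ sum f
sum-three f {i} {j} {l} i≢j i≢l j≢l = begin
  f i + f j + f l
    ≡⟨ sym (cong₂ _+_ (cong₂ _+_ (sum-pick i f) (sum-pick j f)) (sum-pick l f)) ⟩
  sum (pick i) + sum (pick j) + sum (pick l)
    ≡⟨ cong (_+ sum (pick l)) (sym (∑-distrib-+ (pick i) (pick j))) ⟩
  sum (λ t → pick i t + pick j t) + sum (pick l)
    ≡⟨ sym (∑-distrib-+ (λ t → pick i t + pick j t) (pick l)) ⟩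
  sum (λ t → pick i t + pick j t + pick l t)
    ≤⟨ sum-mono-≤ _ f at-most-one ⟩
  sum f ∎
  where
  open ≤-Reasoning
  pick : Fin _ → Fin _ → ℕ
  pick a t = [ a ≟ᵇ t ]· f t
  at-most-one : ∀ t → pick i t + pick j t + pick l t ≤ f t
  at-most-one t with i ≟ᶠ t | j ≟ᶠ t | l ≟ᶠ t
  ... | yes refl | yes refl | _ = ⊥-elim (i≢j refl)
  ... | yes refl | _ | yes refl = ⊥-elim (i≢l refl)
  ... | _ | yes refl | yes refl = ⊥-elim (j≢l refl)
  ... | yes _ | no _ | no _ = ≤-reflexive (trans (+-identityʳ _) (+-identityʳ _))
  ... | no _ | yes _ | no _ = ≤-reflexive (+-identityʳ _)
  ... | no _ | no _ | yes _ = ≤-refl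
  ... | no _ | no _ | no _ = z≤n

sum≡m*c⇒≡c : ∀ {m} (f : Fin m → ℕ) c → (∀ i → c ≤ f i) → sum f ≡ m * c → ∀ i → f i ≡ c
sum≡m*c⇒≡c {suc m} f c c≤f total = at
  where
  rest-≥ : m * c ≤ sum (f ∘ suc)
  rest-≥ = subst (_≤ sum (f ∘ suc)) (sum-const m c) (sum-mono-≤ _ (f ∘ suc) (c≤f ∘ suc))
  head≡ : f zero ≡ c
  head≡ = ≤-antisym (+-cancelʳ-≤ (m * c) (f zero) c (begin
    f zero + m * c        ≤⟨ +-monoʳ-≤ (f zero) rest-≥ ⟩
    f zero + sum (f ∘ suc) ≡⟨ total ⟩
    c + m * c ∎)) (c≤f zero)
    where open ≤-Reasoning
  at : ∀ i → f i ≡ c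
  at zero = head≡
  at (suc i) = sum≡m*c⇒≡c (f ∘ suc) c (c≤f ∘ suc)
    (+-cancelˡ-≡ c _ _ (trans (cong (_+ sum (f ∘ suc)) (sym head≡)) total)) i

sum-involution-invariant : ∀ {m} (φ : Fin m → Fin m) → (∀ i → φ (φ i) ≡ i) →
                           (g : Fin m → ℕ) → sum (g ∘ φ) ≡ sum g
sum-involution-invariant φ φ-inv g = sym (∑-permute g (permutation φ φ φ-inv φ-inv))

_<ᶠᵇ_ : ∀ {m} → Fin m → Fin m → Bool
i <ᶠᵇ j = ⌊ toℕ i <? toℕ j ⌋

trichotomy-split : ∀ {m} (i j : Fin m) x → x ≡ [ i ≟ᵇ j ]· x + ([ i <ᶠᵇ j ]· x + [ j <ᶠᵇ i ]· x)
trichotomy-split i j x with i ≟ᶠ j | toℕ i <? toℕ j | toℕ j <? toℕ i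
... | yes refl | yes i<i | _ = ⊥-elim (<-irrefl refl i<i)
... | yes refl | no _ | yes i<i = ⊥-elim (<-irrefl refl i<i)
... | yes refl | no _ | no _ = sym (+-identityʳ x)
... | no _ | yes i<j | yes j<i = ⊥-elim (<-asym i<j j<i)
... | no _ | yes _ | no _ = sym (+-identityʳ x)
... | no _ | no _ | yes _ = refl
... | no i≢j | no i≮j | no j≮i = ⊥-elim (i≢j (toℕ-injective (≤-antisym (≮⇒≥ j≮i) (≮⇒≥ i≮j))))

sum-involution : ∀ {m} (φ : Fin m → Fin m) → (∀ i → φ (φ i) ≡ i) →
                 (g : Fin m → ℕ) → (∀ i → g (φ i) ≡ g i) →
                 sum g ≡ sum (λ i → [ i ≟ᵇ φ i ]· g i) + 2 * sum (λ i → [ i <ᶠᵇ φ i ]· g i)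
sum-involution φ φ-inv g g∘φ = begin
  sum g
    ≡⟨ sum-cong-≗ (λ i → trichotomy-split i (φ i) (g i)) ⟩
  sum (λ i → fixed i + (up i + down i))
    ≡⟨ ∑-distrib-+ fixed (λ i → up i + down i) ⟩
  sum fixed + sum (λ i → up i + down i)
    ≡⟨ cong (sum fixed +_) (∑-distrib-+ up down) ⟩
  sum fixed + (sum up + sum down)
    ≡⟨ cong (λ s → sum fixed + (sum up + s)) down≡up ⟩
  sum fixed + (sum up + sum up)
    ≡⟨ cong (λ s → sum fixed + (sum up + s)) (sym (+-identityʳ (sum up))) ⟩
  sum fixed + 2 * sum up ∎
  where
  open ≡-Reasoning
  fixed up down : _ → ℕ
  fixed i = [ i ≟ᵇ φ i ]· g i
  up i = [ i <ᶠᵇ φ i ]· g i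
  down i = [ φ i <ᶠᵇ i ]· g i
  down≡up : sum down ≡ sum up
  down≡up = trans (sym (sum-involution-invariant φ φ-inv down))
    (sum-cong-≗ (λ i → cong₂ (λ j y → [ j <ᶠᵇ φ i ]· y) (φ-inv i) (g∘φ i)))

sum-affine-mod : ∀ {len} c m (f e : Fin len → ℕ) →
            (∀ i → ∃ λ t → f i ≡ c * e i + m * t) → ∃ λ t → sum f ≡ c * sum e + m * t
sum-affine-mod {zero} c m f e pointwise = 0 , sym (trans (cong (_+ m * 0) (*-zeroʳ c)) (*-zeroʳ m))
sum-affine-mod {suc len} c m f e pointwise
  with pointwise zero | sum-affine-mod c m (f ∘ suc) (e ∘ suc) (pointwise ∘ suc)
... | t₀ , eq₀ | t , eq = t₀ + t , trans (cong₂ _+_ eq₀ eq) (regroup c (e zero) (sum (e ∘ suc)) m t₀ t)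
  where
  regroup : ∀ c a b m s t → c * a + m * s + (c * b + m * t) ≡ c * (a + b) + m * (s + t)
  regroup = solve-∀

sum-multiple : ∀ {len} m (f : Fin len → ℕ) → (∀ i → ∃ λ t → f i ≡ m * t) → ∃ λ t → sum f ≡ m * t
sum-multiple m f = sum-affine-mod 0 m f f

∑< : ℕ → (ℕ → ℕ) → ℕ
∑< m g = sum {m} (λ i → g (toℕ i))

∑<-cong : ∀ m {f g : ℕ → ℕ} → (∀ i → f i ≡ g i) → ∑< m f ≡ ∑< m g
∑<-cong m f≗g = sum-cong-≗ {m} (λ i → f≗g (toℕ i))

∑<-+ : ∀ a b (g : ℕ → ℕ) → ∑< (a + b) g ≡ ∑< a g + ∑< b (λ i → g (a + i))
∑<-+ zero b g = refl
∑<-+ (suc a) b g = trans (cong (g 0 +_) (∑<-+ a b (g ∘ suc))) (sym (+-assoc (g 0) _ _))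

∑<-suc-last : ∀ q (g : ℕ → ℕ) → ∑< (suc q) g ≡ ∑< q g + g q
∑<-suc-last q g = begin
  ∑< (suc q) g                   ≡⟨ cong (λ m → ∑< m g) (+-comm 1 q) ⟩
  ∑< (q + 1) g                   ≡⟨ ∑<-+ q 1 g ⟩
  ∑< q g + ∑< 1 (λ i → g (q + i)) ≡⟨ cong (∑< q g +_) (trans (+-identityʳ _) (cong g (+-identityʳ q))) ⟩
  ∑< q g + g q ∎
  where open ≡-Reasoning

∑<-rotate : ∀ q (g : ℕ → ℕ) → g q ≡ g 0 → ∑< q g ≡ ∑< q (g ∘ suc)
∑<-rotate q g g-periodic = +-cancelʳ-≡ (g 0) _ _ (begin
  ∑< q g + g 0         ≡⟨ cong (∑< q g +_) (sym g-periodic) ⟩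
  ∑< q g + g q         ≡⟨ sym (∑<-suc-last q g) ⟩
  g 0 + ∑< q (g ∘ suc) ≡⟨ +-comm (g 0) _ ⟩
  ∑< q (g ∘ suc) + g 0 ∎)
  where open ≡-Reasoning

%-absorbˡ : ∀ a b d .{{_ : NonZero d}} → (a % d + b) % d ≡ (a + b) % d
%-absorbˡ a b d = begin
  (a % d + b) % d         ≡⟨ %-distribˡ-+ (a % d) b d ⟩
  (a % d % d + b % d) % d ≡⟨ cong (λ r → (r + b % d) % d) (m%n%n≡m%n a d) ⟩
  (a % d + b % d) % d     ≡⟨ sym (%-distribˡ-+ a b d) ⟩
  (a + b) % d ∎
  where open ≡-Reasoning

%-absorbʳ : ∀ a b d .{{_ : NonZero d}} → (a + b % d) % d ≡ (a + b) % d
%-absorbʳ a b d = trans (cong (_% d) (+-comm a (b % d)))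
  (trans (%-absorbˡ b a d) (cong (_% d) (+-comm b a)))

[m+m+n]%2≡n%2 : ∀ m n → (m + m + n) % 2 ≡ n % 2
[m+m+n]%2≡n%2 m n = trans (cong (_% 2) (trans (+-comm (m + m) n)
  (cong (n +_) (trans (cong (m +_) (sym (+-identityʳ m))) (*-comm 2 m)))))
  ([m+kn]%n≡m%n n m 2)

%2-cancelʳ : ∀ a c d → (a + c) % 2 ≡ (d + c) % 2 → a % 2 ≡ d % 2
%2-cancelʳ a c d eq = begin
  a % 2                 ≡⟨ sym ([m+m+n]%2≡n%2 c a) ⟩
  (c + c + a) % 2       ≡⟨ cong (_% 2) (swap a) ⟩
  (a + c + c) % 2       ≡⟨ sym (%-absorbˡ (a + c) c 2) ⟩
  ((a + c) % 2 + c) % 2 ≡⟨ cong (λ r → (r + c) % 2) eq ⟩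
  ((d + c) % 2 + c) % 2 ≡⟨ %-absorbˡ (d + c) c 2 ⟩
  (d + c + c) % 2       ≡⟨ cong (_% 2) (sym (swap d)) ⟩
  (c + c + d) % 2       ≡⟨ [m+m+n]%2≡n%2 c d ⟩
  d % 2 ∎
  where
  open ≡-Reasoning
  swap : ∀ x → c + c + x ≡ x + c + c
  swap x = trans (+-comm (c + c) x) (sym (+-assoc x c c))

∑<-parity : ∀ t c → ∑< (t + t) (λ i → (i + c) % 2) ≡ t
∑<-parity zero c = refl
∑<-parity (suc t) c = begin
  c % 2 + ∑< (t + suc t) (λ i → (suc i + c) % 2)
    ≡⟨ cong (λ m → c % 2 + ∑< m (λ i → (suc i + c) % 2)) (+-suc t t) ⟩
  c % 2 + (suc c % 2 + ∑< (t + t) (λ i → (2 + i + c) % 2))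
    ≡⟨ sym (+-assoc (c % 2) (suc c % 2) _) ⟩
  (c % 2 + suc c % 2) + ∑< (t + t) (λ i → (2 + i + c) % 2)
    ≡⟨ cong₂ _+_ (consecutive c) (trans (∑<-cong (t + t) (λ i → [m+m+n]%2≡n%2 1 (i + c))) (∑<-parity t c)) ⟩
  1 + t ∎
  where
  open ≡-Reasoning
  consecutive : ∀ c → c % 2 + suc c % 2 ≡ 1
  consecutive zero = refl
  consecutive (suc zero) = refl
  consecutive (suc (suc c)) = consecutive c

double-isEven : ∀ j → isEven (j + j) ≡ true
double-isEven j with (j + j) % 2 ≟ 0
... | yes _ = refl
... | no j+j%2≢0 = ⊥-elim (j+j%2≢0 (trans (cong (_% 2) (sym (+-identityʳ (j + j)))) ([m+m+n]%2≡n%2 j 0)))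

%2≡0⊎%2≡1 : ∀ m → m % 2 ≡ 0 ⊎ m % 2 ≡ 1
%2≡0⊎%2≡1 m with m % 2 | m%n<n m 2
... | zero | _ = inj₁ refl
... | suc zero | _ = inj₂ refl
... | suc (suc _) | s≤s (s≤s ())

even-positive⇒≥2 : ∀ {m} t → m ≡ 2 * t → 1 ≤ m → 2 ≤ m
even-positive⇒≥2 zero refl ()
even-positive⇒≥2 (suc t) refl _ = s≤s (≤-trans (s≤s z≤n) (m≤n+m (suc (t + 0)) t))

module Residues (k : ℕ) where

  n M : ℕ
  n = suc k
  M = 2 * suc k

  M≡n+n : M ≡ n + n
  M≡n+n = cong (n +_) (+-identityʳ n)

  toℕ-modZ : ∀ a → toℕ (modZ k a) ≡ a % M
  toℕ-modZ a = toℕ-fromℕ< _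

  toℕ%M : (x : Zn k) → toℕ x % M ≡ toℕ x
  toℕ%M x = m<n⇒m%n≡m (toℕ<n x)

  ⊖-inverse : (x y : Zn k) → (toℕ (x ⊖ y) + toℕ y) % M ≡ toℕ x
  ⊖-inverse x y = begin
    (toℕ (x ⊖ y) + toℕ y) % M                 ≡⟨ cong (λ r → (r + toℕ y) % M) (toℕ-modZ (toℕ x + (M ∸ toℕ y))) ⟩
    ((toℕ x + (M ∸ toℕ y)) % M + toℕ y) % M   ≡⟨ %-absorbˡ (toℕ x + (M ∸ toℕ y)) (toℕ y) M ⟩
    (toℕ x + (M ∸ toℕ y) + toℕ y) % M         ≡⟨ cong (_% M) (+-assoc (toℕ x) _ (toℕ y)) ⟩
    (toℕ x + ((M ∸ toℕ y) + toℕ y)) % M       ≡⟨ cong (λ r → (toℕ x + r) % M) (m∸n+n≡m (<⇒≤ (toℕ<n y))) ⟩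
    (toℕ x + M) % M                           ≡⟨ [m+n]%n≡m%n (toℕ x) M ⟩
    toℕ x % M                                 ≡⟨ toℕ%M x ⟩
    toℕ x ∎
    where open ≡-Reasoning

  ⊖-unique : (x y d : Zn k) → (toℕ d + toℕ y) % M ≡ toℕ x → d ≡ x ⊖ y
  ⊖-unique x y d d+y≡x = toℕ-injective (begin
    toℕ d                                     ≡⟨ sym (toℕ%M d) ⟩
    toℕ d % M                                 ≡⟨ sym ([m+n]%n≡m%n (toℕ d) M) ⟩
    (toℕ d + M) % M                           ≡⟨ cong (λ r → (toℕ d + r) % M) (sym (m+[n∸m]≡n (<⇒≤ (toℕ<n y)))) ⟩
    (toℕ d + (toℕ y + (M ∸ toℕ y))) % M       ≡⟨ cong (_% M) (sym (+-assoc (toℕ d) (toℕ y) _)) ⟩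
    (toℕ d + toℕ y + (M ∸ toℕ y)) % M         ≡⟨ sym (%-absorbˡ (toℕ d + toℕ y) _ M) ⟩
    ((toℕ d + toℕ y) % M + (M ∸ toℕ y)) % M   ≡⟨ cong (λ r → (r + (M ∸ toℕ y)) % M) d+y≡x ⟩
    (toℕ x + (M ∸ toℕ y)) % M                 ≡⟨ sym (toℕ-modZ (toℕ x + (M ∸ toℕ y))) ⟩
    toℕ (x ⊖ y) ∎)
    where open ≡-Reasoning

  ⊖≡0⇒≡ : (x y : Zn k) → toℕ (x ⊖ y) ≡ 0 → x ≡ y
  ⊖≡0⇒≡ x y x⊖y≡0 = toℕ-injective (trans (sym (⊖-inverse x y))
    (trans (cong (λ r → (r + toℕ y) % M) x⊖y≡0) (toℕ%M y)))

  σ : Zn k → Zn k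
  σ x = addZ x n

  toℕ-σ : ∀ x → toℕ (σ x) ≡ (toℕ x + n) % M
  toℕ-σ x = toℕ-modZ (toℕ x + n)

  σ-involutive : ∀ x → σ (σ x) ≡ x
  σ-involutive x = toℕ-injective (begin
    toℕ (σ (σ x))            ≡⟨ toℕ-σ (σ x) ⟩
    (toℕ (σ x) + n) % M      ≡⟨ cong (λ r → (r + n) % M) (toℕ-σ x) ⟩
    ((toℕ x + n) % M + n) % M ≡⟨ %-absorbˡ (toℕ x + n) n M ⟩
    (toℕ x + n + n) % M      ≡⟨ cong (_% M) (trans (+-assoc (toℕ x) n n) (cong (toℕ x +_) (sym M≡n+n))) ⟩
    (toℕ x + M) % M          ≡⟨ [m+n]%n≡m%n (toℕ x) M ⟩
    toℕ x % M                ≡⟨ toℕ%M x ⟩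
    toℕ x ∎)
    where open ≡-Reasoning

  ⊖-σ : ∀ x y → σ x ⊖ σ y ≡ x ⊖ y
  ⊖-σ x y = sym (⊖-unique (σ x) (σ y) (x ⊖ y) (begin
    (toℕ (x ⊖ y) + toℕ (σ y)) % M          ≡⟨ cong (λ r → (toℕ (x ⊖ y) + r) % M) (toℕ-σ y) ⟩
    (toℕ (x ⊖ y) + (toℕ y + n) % M) % M    ≡⟨ %-absorbʳ (toℕ (x ⊖ y)) (toℕ y + n) M ⟩
    (toℕ (x ⊖ y) + (toℕ y + n)) % M        ≡⟨ cong (_% M) (sym (+-assoc (toℕ (x ⊖ y)) (toℕ y) n)) ⟩
    (toℕ (x ⊖ y) + toℕ y + n) % M          ≡⟨ sym (%-absorbˡ (toℕ (x ⊖ y) + toℕ y) n M) ⟩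
    ((toℕ (x ⊖ y) + toℕ y) % M + n) % M    ≡⟨ cong (λ r → (r + n) % M) (⊖-inverse x y) ⟩
    (toℕ x + n) % M                        ≡⟨ sym (toℕ-σ x) ⟩
    toℕ (σ x) ∎))
    where open ≡-Reasoning

  n<M : n < M
  n<M = subst (n <_) (sym M≡n+n) (m<m+n n (s≤s z≤n))

  half : Zn k
  half = fromℕ< n<M

  toℕ-half : toℕ half ≡ n
  toℕ-half = toℕ-fromℕ< n<M

  x⊖σx≡half : ∀ x → x ⊖ σ x ≡ half
  x⊖σx≡half x = sym (⊖-unique x (σ x) half (begin
    (toℕ half + toℕ (σ x)) % M    ≡⟨ cong₂ (λ a b → (a + b) % M) toℕ-half (toℕ-σ x) ⟩
    (n + (toℕ x + n) % M) % M     ≡⟨ %-absorbʳ n (toℕ x + n) M ⟩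
    (n + (toℕ x + n)) % M         ≡⟨ cong (_% M) (trans (+-comm n (toℕ x + n))
                                       (trans (+-assoc (toℕ x) n n) (cong (toℕ x +_) (sym M≡n+n)))) ⟩
    (toℕ x + M) % M               ≡⟨ [m+n]%n≡m%n (toℕ x) M ⟩
    toℕ x % M                     ≡⟨ toℕ%M x ⟩
    toℕ x ∎))
    where open ≡-Reasoning

  ⊖≡half⇒σ : ∀ x y → x ⊖ y ≡ half → y ≡ σ x
  ⊖≡half⇒σ x y x⊖y≡half = toℕ-injective (sym (begin
    toℕ (σ x)                               ≡⟨ toℕ-σ x ⟩
    (toℕ x + n) % M                         ≡⟨ cong (λ r → (r + n) % M) (sym (⊖-inverse x y)) ⟩
    ((toℕ (x ⊖ y) + toℕ y) % M + n) % M     ≡⟨ %-absorbˡ (toℕ (x ⊖ y) + toℕ y) n M ⟩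
    (toℕ (x ⊖ y) + toℕ y + n) % M           ≡⟨ cong (λ d → (toℕ d + toℕ y + n) % M) x⊖y≡half ⟩
    (toℕ half + toℕ y + n) % M              ≡⟨ cong (λ h → (h + toℕ y + n) % M) toℕ-half ⟩
    (n + toℕ y + n) % M                     ≡⟨ cong (_% M) (trans (cong (_+ n) (+-comm n (toℕ y)))
                                                 (trans (+-assoc (toℕ y) n n) (cong (toℕ y +_) (sym M≡n+n)))) ⟩
    (toℕ y + M) % M                         ≡⟨ [m+n]%n≡m%n (toℕ y) M ⟩
    toℕ y % M                               ≡⟨ toℕ%M y ⟩
    toℕ y ∎))
    where open ≡-Reasoning

  σx≢x : ∀ x → σ x ≢ x
  σx≢x x σx≡x = 0≢1+n (trans (sym x⊖x≡0) (trans (cong (λ y → toℕ (x ⊖ y)) (sym σx≡x))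
    (trans (cong toℕ (x⊖σx≡half x)) toℕ-half)))
    where
    x⊖x≡0 : toℕ (x ⊖ x) ≡ 0
    x⊖x≡0 = cong toℕ (sym (⊖-unique x x zero (toℕ%M x)))

  %M%2 : ∀ a → a % M % 2 ≡ a % 2
  %M%2 a = m∣n⇒o%n%m≡o%m 2 M a (m∣m*n n)

  ⊖-parity : ∀ x y → toℕ (x ⊖ y) % 2 ≡ (toℕ x + toℕ y) % 2
  ⊖-parity x y = sym (begin
    (toℕ x + toℕ y) % 2                     ≡⟨ sym (%-absorbˡ (toℕ x) (toℕ y) 2) ⟩
    (toℕ x % 2 + toℕ y) % 2                 ≡⟨ cong (λ r → (r % 2 + toℕ y) % 2) (sym (⊖-inverse x y)) ⟩
    ((toℕ d + toℕ y) % M % 2 + toℕ y) % 2   ≡⟨ cong (λ r → (r + toℕ y) % 2) (%M%2 (toℕ d + toℕ y)) ⟩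
    ((toℕ d + toℕ y) % 2 + toℕ y) % 2       ≡⟨ %-absorbˡ (toℕ d + toℕ y) (toℕ y) 2 ⟩
    (toℕ d + toℕ y + toℕ y) % 2             ≡⟨ cong (_% 2) (trans (+-assoc (toℕ d) (toℕ y) (toℕ y)) (+-comm (toℕ d) _)) ⟩
    (toℕ y + toℕ y + toℕ d) % 2             ≡⟨ [m+m+n]%2≡n%2 (toℕ y) (toℕ d) ⟩
    toℕ d % 2 ∎)
    where
    open ≡-Reasoning
    d = x ⊖ y

  σ-parity : ∀ x → toℕ (σ x) % 2 ≡ (toℕ x + n) % 2
  σ-parity x = trans (cong (_% 2) (toℕ-σ x)) (%M%2 (toℕ x + n))

  ∑-parity : sum (λ (d : Zn k) → toℕ d % 2) ≡ n
  ∑-parity = trans (cong (λ m → ∑< m (_% 2)) M≡n+n)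
    (trans (∑<-cong (n + n) (λ i → cong (_% 2) (sym (+-identityʳ i)))) (∑<-parity n 0))

  parity : Vtx k → ℕ
  parity nothing = 0
  parity (just x) = toℕ x % 2

  parity-%2 : ∀ v → parity v % 2 ≡ parity v
  parity-%2 nothing = refl
  parity-%2 (just x) = m%n%n≡m%n (toℕ x) 2

  -- Edges at ∞ contribute nothing to ΔF, so they never count as parity changes.
  crossing : Vtx k → Vtx k → ℕ
  crossing (just x) (just y) = (toℕ x + toℕ y) % 2
  crossing _ _ = 0

  crossing-sym : ∀ v w → crossing v w ≡ crossing w v
  crossing-sym (just x) (just y) = cong (_% 2) (+-comm (toℕ x) (toℕ y))
  crossing-sym (just x) nothing = refl
  crossing-sym nothing (just y) = refl
  crossing-sym nothing nothing = refl

  crossing-∞ʳ : ∀ v → crossing v nothing ≡ 0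
  crossing-∞ʳ (just x) = refl
  crossing-∞ʳ nothing = refl

  crossing-just : ∀ x y → crossing (just x) (just y) ≡ (parity (just x) + parity (just y)) % 2
  crossing-just x y = sym (trans (%-absorbˡ (toℕ x) (toℕ y % 2) 2) (%-absorbʳ (toℕ x) (toℕ y) 2))

  crossing-σ : ∀ v w → crossing (shiftV n v) (shiftV n w) ≡ crossing v w
  crossing-σ (just x) (just y) = begin
    (toℕ (σ x) + toℕ (σ y)) % 2               ≡⟨ sym (trans (%-absorbˡ (toℕ (σ x)) (toℕ (σ y) % 2) 2) (%-absorbʳ (toℕ (σ x)) (toℕ (σ y)) 2)) ⟩
    (toℕ (σ x) % 2 + toℕ (σ y) % 2) % 2       ≡⟨ cong₂ (λ a b → (a + b) % 2) (σ-parity x) (σ-parity y) ⟩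
    ((toℕ x + n) % 2 + (toℕ y + n) % 2) % 2   ≡⟨ trans (%-absorbˡ (toℕ x + n) ((toℕ y + n) % 2) 2) (%-absorbʳ (toℕ x + n) (toℕ y + n) 2) ⟩
    (toℕ x + n + (toℕ y + n)) % 2             ≡⟨ cong (_% 2) (regroup (toℕ x) (toℕ y) n) ⟩
    (n + n + (toℕ x + toℕ y)) % 2             ≡⟨ [m+m+n]%2≡n%2 n (toℕ x + toℕ y) ⟩
    (toℕ x + toℕ y) % 2 ∎
    where
    open ≡-Reasoning
    regroup : ∀ a b c → a + c + (b + c) ≡ c + c + (a + b)
    regroup = solve-∀
  crossing-σ (just x) nothing = refl
  crossing-σ nothing (just y) = refl
  crossing-σ nothing nothing = refl

  crossing-σ-self : ∀ x → crossing (just x) (just (σ x)) ≡ n % 2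
  crossing-σ-self x = begin
    (toℕ x + toℕ (σ x)) % 2       ≡⟨ sym (%-absorbʳ (toℕ x) (toℕ (σ x)) 2) ⟩
    (toℕ x + toℕ (σ x) % 2) % 2   ≡⟨ cong (λ r → (toℕ x + r) % 2) (σ-parity x) ⟩
    (toℕ x + (toℕ x + n) % 2) % 2 ≡⟨ %-absorbʳ (toℕ x) (toℕ x + n) 2 ⟩
    (toℕ x + (toℕ x + n)) % 2     ≡⟨ cong (_% 2) (sym (+-assoc (toℕ x) (toℕ x) n)) ⟩
    (toℕ x + toℕ x + n) % 2       ≡⟨ [m+m+n]%2≡n%2 (toℕ x) n ⟩
    n % 2 ∎
    where open ≡-Reasoning

true≢false : true ≢ false
true≢false ()

Bool-ext : ∀ {a b : Bool} → (a ≡ true → b ≡ true) → (b ≡ true → a ≡ true) → a ≡ b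
Bool-ext {false} {false} _ _ = refl
Bool-ext {false} {true} _ b⇒a = b⇒a refl
Bool-ext {true} {false} a⇒b _ = sym (a⇒b refl)
Bool-ext {true} {true} _ _ = refl

any-intro : ∀ {A : Set} (p : A → Bool) {x} xs → x ∈ xs → p x ≡ true → any p xs ≡ true
any-intro p (y ∷ xs) (here refl) px rewrite px = refl
any-intro p (y ∷ xs) (there x∈xs) px with p y
... | true = refl
... | false = any-intro p xs x∈xs px

any-elim : ∀ {A : Set} (p : A → Bool) xs → any p xs ≡ true → ∃ λ x → p x ≡ true
any-elim p (y ∷ xs) any≡true with p y in py
... | true = y , py
... | false = any-elim p xs any≡true

all-intro : ∀ {A : Set} (p : A → Bool) xs → (∀ x → p x ≡ true) → all p xs ≡ true
all-intro p [] _ = refl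
all-intro p (y ∷ xs) p≡true rewrite p≡true y = all-intro p xs p≡true

all-elim : ∀ {A : Set} (p : A → Bool) {x} xs → all p xs ≡ true → x ∈ xs → p x ≡ true
all-elim p (y ∷ xs) all≡true (here refl) with p y
... | true = refl
all-elim p (y ∷ xs) all≡true (there x∈xs) with p y
... | true = all-elim p xs all≡true x∈xs

all-counterexample : ∀ {A : Set} (p : A → Bool) xs → all p xs ≡ false → ∃ λ x → p x ≡ false
all-counterexample p (y ∷ xs) all≡false with p y in py
... | true = all-counterexample p xs all≡false
... | false = y , py

length-filterᵇ-tabulate : ∀ {A : Set} (P : A → Bool) m (f : Fin m → A) →
  length (filterᵇ P (tabulate f)) ≡ sum (λ i → [ P (f i) ]· 1)
length-filterᵇ-tabulate P zero f = refl
length-filterᵇ-tabulate P (suc m) f with P (f zero)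
... | true = cong suc (length-filterᵇ-tabulate P m (f ∘ suc))
... | false = length-filterᵇ-tabulate P m (f ∘ suc)

Least : (ℕ → Set) → ℕ → Set
Least P m = P m × (∀ {j} → j < m → ¬ P j)

least : ∀ {P : ℕ → Set} → (∀ m → Dec (P m)) → ∀ {q} → P q → ∃ (Least P)
least {P} P? {q} = <-rec (λ q → P q → ∃ (Least P)) below q
  where
  below : ∀ q → (∀ {j} → j < q → P j → ∃ (Least P)) → P q → ∃ (Least P)
  below q smaller Pq with anyUpTo? P? q
  ... | yes (j , j<q , Pj) = smaller j<q Pj
  ... | no none = q , Pq , λ j<q Pj → none (_ , j<q , Pj)


module Vertices (k : ℕ) where

  V : Set
  V = Vtx k

  S : ℕ
  S = suc (2 * suc k)

  vertex : Fin S → V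
  vertex zero = nothing
  vertex (suc x) = just x

  index : V → Fin S
  index nothing = zero
  index (just x) = suc x

  vertex-index : ∀ v → vertex (index v) ≡ v
  vertex-index nothing = refl
  vertex-index (just x) = refl

  index-vertex : ∀ i → index (vertex i) ≡ i
  index-vertex zero = refl
  index-vertex (suc i) = refl

  index-injective : ∀ {v w} → index v ≡ index w → v ≡ w
  index-injective {v} {w} eq = trans (sym (vertex-index v)) (trans (cong vertex eq) (vertex-index w))

  _≟ᵛ_ : (v w : V) → Dec (v ≡ w)
  _≟ᵛ_ = ≡-dec-Maybe _≟ᶠ_

  ==-≡ : ∀ {v w : V} → (v == w) ≡ true → v ≡ w
  ==-≡ {v} {w} v==w with v ≟ᵛ w
  ... | yes v≡w = v≡w

  ==-refl : ∀ (v : V) → (v == v) ≡ true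
  ==-refl v with v ≟ᵛ v
  ... | yes _ = refl
  ... | no v≢v = ⊥-elim (v≢v refl)

  ∑V : (V → ℕ) → ℕ
  ∑V g = sum (g ∘ vertex)

  ∑V-cong : {f g : V → ℕ} → (∀ v → f v ≡ g v) → ∑V f ≡ ∑V g
  ∑V-cong f≗g = sum-cong-≗ (f≗g ∘ vertex)

  ∑V-distrib-+ : (f g : V → ℕ) → ∑V (λ v → f v + g v) ≡ ∑V f + ∑V g
  ∑V-distrib-+ f g = ∑-distrib-+ (f ∘ vertex) (g ∘ vertex)

  index-≟ᵇ : ∀ v w → (index v ≟ᵇ index w) ≡ (v == w)
  index-≟ᵇ v w with index v ≟ᶠ index w | v ≟ᵛ w
  ... | yes _ | yes _ = refl
  ... | no _ | no _ = refl
  ... | yes iv≡iw | no v≢w = ⊥-elim (v≢w (index-injective iv≡iw))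
  ... | no iv≢iw | yes refl = ⊥-elim (iv≢iw refl)

  ∑V-pick : ∀ (w : V) (g : V → ℕ) → ∑V (λ v → [ w == v ]· g v) ≡ g w
  ∑V-pick w g = trans (sum-cong-≗ same-weights)
    (trans (sum-pick (index w) (g ∘ vertex)) (cong g (vertex-index w)))
    where
    same-weights : ∀ i → [ w == vertex i ]· g (vertex i) ≡ [ index w ≟ᵇ i ]· g (vertex i)
    same-weights i = cong (λ b → [ b ]· g (vertex i))
      (trans (sym (index-≟ᵇ w (vertex i))) (cong (index w ≟ᵇ_) (index-vertex i)))

  ∑V-comm : (f : V → V → ℕ) → ∑V (λ u → ∑V (λ v → f u v)) ≡ ∑V (λ v → ∑V (λ u → f u v))
  ∑V-comm f = ∑-comm (λ i j → f (vertex i) (vertex j))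

  module _ (ψ : V → V) (ψ-involutive : ∀ v → ψ (ψ v) ≡ v) where

    private
      ψᶠ : Fin S → Fin S
      ψᶠ i = index (ψ (vertex i))

      ψᶠ-involutive : ∀ i → ψᶠ (ψᶠ i) ≡ i
      ψᶠ-involutive i = trans (cong (index ∘ ψ) (vertex-index (ψ (vertex i))))
        (trans (cong index (ψ-involutive (vertex i))) (index-vertex i))

      vertex-ψᶠ : ∀ i → vertex (ψᶠ i) ≡ ψ (vertex i)
      vertex-ψᶠ i = vertex-index (ψ (vertex i))

    ∑V-involution-invariant : (g : V → ℕ) → ∑V (g ∘ ψ) ≡ ∑V g
    ∑V-involution-invariant g = trans (sum-cong-≗ (λ i → cong g (sym (vertex-ψᶠ i))))
      (sum-involution-invariant ψᶠ ψᶠ-involutive (g ∘ vertex))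

    ∑V-involution : (h : V → ℕ) → (∀ v → h (ψ v) ≡ h v) →
      ∑V h ≡ ∑V (λ v → [ v == ψ v ]· h v) + 2 * ∑V (λ v → [ index v <ᶠᵇ index (ψ v) ]· h v)
    ∑V-involution h h∘ψ = trans
      (sum-involution ψᶠ ψᶠ-involutive (h ∘ vertex) (λ i → trans (cong h (vertex-ψᶠ i)) (h∘ψ (vertex i))))
      (cong₂ (λ a b → a + 2 * b)
        (sum-cong-≗ (λ i → trans (cong (λ j → [ j ≟ᵇ ψᶠ i ]· h (vertex i)) (sym (index-vertex i)))
                                 (cong (λ b → [ b ]· h (vertex i)) (index-≟ᵇ (vertex i) (ψ (vertex i))))))
        (sum-cong-≗ (λ i → cong (λ j → [ j <ᶠᵇ ψᶠ i ]· h (vertex i)) (sym (index-vertex i)))))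

  vertices-complete : ∀ (v : V) → v ∈ vertices k
  vertices-complete nothing = here refl
  vertices-complete (just x) = there (∈-map⁺ just (∈-allFin x))

  vertices-unique : Unique (vertices k)
  vertices-unique = nothing∉ (allFin (2 * suc k)) ∷ Unique.map⁺ just-injective (Unique.allFin⁺ (2 * suc k))
    where
    nothing∉ : ∀ xs → All (nothing ≢_) (map just xs)
    nothing∉ [] = []
    nothing∉ (x ∷ xs) = (λ ()) ∷ nothing∉ xs

  length-filterᵇ-vertices : (P : V → Bool) → length (filterᵇ P (vertices k)) ≡ ∑V (λ v → [ P v ]· 1)
  length-filterᵇ-vertices P =
    trans (cong (λ xs → length (filterᵇ P (nothing ∷ xs))) (map-tabulate (λ i → i) just))
          (length-filterᵇ-tabulate P S vertex)

module TwoRegular (k : ℕ) (F : Graph k) (simple : IsSimple F) (deg≡2 : ∀ v → degree F v ≡ 2) where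

  open Vertices k
  open Residues k using (parity; parity-%2; crossing; crossing-sym; crossing-just)

  Adj : V → V → Set
  Adj v w = F v w ≡ true

  adj-sym : ∀ {v w} → Adj v w → Adj w v
  adj-sym {v} {w} vw = trans (proj₁ simple w v) vw

  adj⇒≢ : ∀ {v w} → Adj v w → v ≢ w
  adj⇒≢ {v} vv refl = true≢false (trans (sym vv) (proj₂ simple v))

  record Neighbours (v : V) : Set where
    field
      first second : V
      adj-first : Adj v first
      adj-second : Adj v second
      first≢second : first ≢ second
      only : ∀ w → Adj v w → w ≡ first ⊎ w ≡ second

  neighbours : ∀ v → Neighbours v
  neighbours v = from-list (filterᵇ (F v) (vertices k)) refl (deg≡2 v)
    where
    adjacent : ∀ {w} → w ∈ filterᵇ (F v) (vertices k) → Adj v w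
    adjacent w∈ = Equivalence.to T-≡ (proj₂ (∈-filter⁻ (T? ∘ F v) {xs = vertices k} w∈))
    from-list : ∀ xs → xs ≡ filterᵇ (F v) (vertices k) → length xs ≡ 2 → Neighbours v
    from-list (a ∷ b ∷ []) eq _ = record
      { first = a
      ; second = b
      ; adj-first = adjacent (subst (a ∈_) eq (here refl))
      ; adj-second = adjacent (subst (b ∈_) eq (there (here refl)))
      ; first≢second = a≢b
      ; only = λ w vw → member (subst (w ∈_) (sym eq)
                          (∈-filter⁺ (T? ∘ F v) (vertices-complete w) (Equivalence.from T-≡ vw)))
      }
      where
      a≢b : a ≢ b
      a≢b with subst Unique (sym eq) (Unique.filter⁺ (T? ∘ F v) vertices-unique)
      ... | (a≢b ∷ _) ∷ _ = a≢b
      member : ∀ {w} → w ∈ a ∷ b ∷ [] → w ≡ a ⊎ w ≡ b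
      member (here w≡a) = inj₁ w≡a
      member (there (here w≡b)) = inj₂ w≡b

  other : V → V → V
  other v a with a ≟ᵛ Neighbours.first (neighbours v)
  ... | yes _ = Neighbours.second (neighbours v)
  ... | no _ = Neighbours.first (neighbours v)

  module _ {v a : V} (va : Adj v a) where
    open Neighbours (neighbours v)

    other-adj : Adj v (other v a)
    other-adj with a ≟ᵛ first
    ... | yes _ = adj-second
    ... | no _ = adj-first

    other≢ : other v a ≢ a
    other≢ with a ≟ᵛ first
    ... | yes refl = first≢second ∘ sym
    ... | no a≢first = a≢first ∘ sym

    adj⇒≡⊎≡other : ∀ w → Adj v w → w ≡ a ⊎ w ≡ other v a
    adj⇒≡⊎≡other w vw with a ≟ᵛ first | only w vw
    ... | yes refl | inj₁ w≡a = inj₁ w≡a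
    ... | yes refl | inj₂ w≡second = inj₂ w≡second
    ... | no _ | inj₁ w≡first = inj₂ w≡first
    ... | no a≢first | inj₂ refl with only a va
    ...   | inj₁ a≡first = ⊥-elim (a≢first a≡first)
    ...   | inj₂ refl = inj₁ refl

    adj≢⇒other : ∀ w → Adj v w → w ≢ a → w ≡ other v a
    adj≢⇒other w vw w≢a with adj⇒≡⊎≡other w vw
    ... | inj₁ w≡a = ⊥-elim (w≢a w≡a)
    ... | inj₂ w≡other = w≡other

  other-involutive : ∀ {v a} → Adj v a → other v (other v a) ≡ a
  other-involutive va = sym (adj≢⇒other (other-adj va) _ va (other≢ va ∘ sym))

  ∑-neighbours : ∀ {v a} → Adj v a → (g : V → ℕ) → ∑V (λ w → [ F v w ]· g w) ≡ g a + g (other v a)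
  ∑-neighbours {v} {a} va g = begin
    ∑V (λ w → [ F v w ]· g w)                              ≡⟨ ∑V-cong split ⟩
    ∑V (λ w → [ a == w ]· g w + [ other v a == w ]· g w)   ≡⟨ ∑V-distrib-+ (λ w → [ a == w ]· g w) (λ w → [ other v a == w ]· g w) ⟩
    ∑V (λ w → [ a == w ]· g w) + ∑V (λ w → [ other v a == w ]· g w)
                                                           ≡⟨ cong₂ _+_ (∑V-pick a g) (∑V-pick (other v a) g) ⟩
    g a + g (other v a) ∎
    where
    open ≡-Reasoning
    split : ∀ w → [ F v w ]· g w ≡ [ a == w ]· g w + [ other v a == w ]· g w
    split w with F v w in vw | a ≟ᵛ w | other v a ≟ᵛ w
    ... | true | yes refl | yes o≡a = ⊥-elim (other≢ va o≡a)
    ... | true | yes _ | no _ = sym (+-identityʳ (g w))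
    ... | true | no _ | yes _ = refl
    ... | true | no a≢w | no o≢w with adj⇒≡⊎≡other va w vw
    ...   | inj₁ w≡a = ⊥-elim (a≢w (sym w≡a))
    ...   | inj₂ w≡o = ⊥-elim (o≢w (sym w≡o))
    split w | false | yes refl | _ = ⊥-elim (true≢false (trans (sym va) vw))
    split w | false | no _ | yes refl = ⊥-elim (true≢false (trans (sym (other-adj va)) vw))
    split w | false | no _ | no _ = refl

  Dart : Set
  Dart = V × V

  step : Dart → Dart
  step (a , b) = b , other b a

  dart : V → ℕ → Dart
  dart u zero = u , Neighbours.first (neighbours u)
  dart u (suc i) = step (dart u i)

  walk : V → ℕ → V
  walk u i = proj₁ (dart u i)

  encode : Dart → Fin (S * S)
  encode (a , b) = combine (index a) (index b)

  encode-injective : ∀ {d e} → encode d ≡ encode e → d ≡ e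
  encode-injective {a , b} {c , d} eq with combine-injective (index a) (index b) (index c) (index d) eq
  ... | ia≡ic , ib≡id = cong₂ _,_ (index-injective ia≡ic) (index-injective ib≡id)

  reach-suc : ∀ t {a b} → reach F t a b ≡ true → reach F (suc t) a b ≡ true
  reach-suc t ab rewrite ab = refl

  reach-mono : ∀ {t t′ a b} → t ≤ t′ → reach F t a b ≡ true → reach F t′ a b ≡ true
  reach-mono {t} {a = a} {b} t≤t′ ab with m≤n⇒∃[o]m+o≡n t≤t′
  ... | o , refl = longer o
    where
    longer : ∀ o → reach F (t + o) a b ≡ true
    longer zero = subst (λ s → reach F s a b ≡ true) (sym (+-identityʳ t)) ab
    longer (suc o) = subst (λ s → reach F s a b ≡ true) (sym (+-suc t o)) (reach-suc (t + o) (longer o))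

  reach-closed : (C : V → Set) → (∀ {w v} → C w → Adj w v → C v) →
                 ∀ t {a b} → C a → reach F t a b ≡ true → C b
  reach-closed C closed zero Ca ab = subst C (==-≡ ab) Ca
  reach-closed C closed (suc t) {a} {b} Ca ab with reach F t a b in ab′
  ... | true = reach-closed C closed t Ca ab′
  ... | false with any-elim (λ w → reach F t a w ∧ F w b) (vertices k) ab
  ...   | w , aw∧wb with reach F t a w in aw | F w b in wb
  ...     | true | true = closed (reach-closed C closed t Ca aw) wb

  module Cycle (u : V) where

    X : ℕ → V
    X = walk u

    D : ℕ → Dart
    D = dart u

    walk-adj : ∀ i → Adj (X i) (X (suc i))
    walk-adj zero = Neighbours.adj-first (neighbours u)
    walk-adj (suc i) = other-adj (adj-sym (walk-adj i))

    walk-back : ∀ i → X i ≡ other (X (suc i)) (X (suc (suc i)))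
    walk-back i = sym (other-involutive (adj-sym (walk-adj i)))

    walk-no-backtrack : ∀ i → X (suc (suc i)) ≢ X i
    walk-no-backtrack i = other≢ (adj-sym (walk-adj i))

    dart-cancel : ∀ a {i j} → D (a + i) ≡ D (a + j) → D i ≡ D j
    dart-cancel zero eq = eq
    dart-cancel (suc a) {i} {j} eq = dart-cancel a (cong₂ _,_
      (trans (walk-back (a + i)) (trans (cong₂ other X₁ X₂) (sym (walk-back (a + j))))) X₁)
      where
      X₁ : X (suc (a + i)) ≡ X (suc (a + j))
      X₁ = cong proj₁ eq
      X₂ : X (suc (suc (a + i))) ≡ X (suc (suc (a + j)))
      X₂ = cong proj₂ eq

    abstract
      returns : ∃ λ q → D (suc q) ≡ D 0
      returns with pigeonhole (n<1+n (S * S)) (λ i → encode (D (toℕ i)))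
      ... | i , j , i<j , eq with m≤n⇒∃[o]m+o≡n i<j
      ...   | q , i+1+q≡j = q , sym (dart-cancel (toℕ i) (begin
        D (toℕ i + 0)     ≡⟨ cong D (+-identityʳ (toℕ i)) ⟩
        D (toℕ i)         ≡⟨ encode-injective eq ⟩
        D (toℕ j)         ≡⟨ cong D (sym (trans (+-suc (toℕ i) q) i+1+q≡j)) ⟩
        D (toℕ i + suc q) ∎))
        where open ≡-Reasoning

      first-return : ∃ (Least (λ m → D (suc m) ≡ D 0))
      first-return = least {λ m → D (suc m) ≡ D 0} (λ m → ≡-dec-× _≟ᵛ_ _≟ᵛ_ (D (suc m)) (D 0)) {proj₁ returns} (proj₂ returns)

    p : ℕ
    p = suc (proj₁ first-return)

    dart-period : ∀ i → D (i + p) ≡ D i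
    dart-period zero = proj₁ (proj₂ first-return)
    dart-period (suc i) = cong step (dart-period i)

    walk-period : ∀ i → X (i + p) ≡ X i
    walk-period i = cong proj₁ (dart-period i)

    walk-period-* : ∀ i m → X (i + m * p) ≡ X i
    walk-period-* i zero = cong X (+-identityʳ i)
    walk-period-* i (suc m) = begin
      X (i + (p + m * p)) ≡⟨ cong X (trans (cong (i +_) (+-comm p (m * p))) (sym (+-assoc i (m * p) p))) ⟩
      X (i + m * p + p)   ≡⟨ walk-period (i + m * p) ⟩
      X (i + m * p)       ≡⟨ walk-period-* i m ⟩
      X i ∎
      where open ≡-Reasoning

    walk-before : ∀ i → X (suc (i + proj₁ first-return)) ≡ X i
    walk-before i = trans (cong X (sym (+-suc i (proj₁ first-return)))) (walk-period i)

    dart-injective : ∀ {i j} → i < j → j < p → D i ≢ D j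
    dart-injective {i} {j} i<j j<p Di≡Dj with m≤n⇒∃[o]m+o≡n i<j
    ... | r , 1+i+r≡j = proj₂ (proj₂ first-return) r<m (sym (dart-cancel i (begin
      D (i + 0)     ≡⟨ cong D (+-identityʳ i) ⟩
      D i           ≡⟨ Di≡Dj ⟩
      D j           ≡⟨ cong D (sym (trans (+-suc i r) 1+i+r≡j)) ⟩
      D (i + suc r) ∎)))
      where
      open ≡-Reasoning
      r<m : r < proj₁ first-return
      r<m = ≤-trans (s≤s (m≤n+m r i)) (≤-trans (≤-reflexive 1+i+r≡j) (≤-pred j<p))

    -- Shrinking a retraced segment from both ends ends in a loop or in a backtrack.
    walk-not-reversed : ∀ g a → X a ≡ X (a + suc g) → X (suc a) ≡ X (a + g) → ⊥
    walk-not-reversed zero a _ eq₂ = adj⇒≢ (walk-adj a) (sym (trans eq₂ (cong X (+-identityʳ a))))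
    walk-not-reversed (suc zero) a eq₁ _ = walk-no-backtrack a (sym (trans eq₁ (cong X (+-comm a 2))))
    walk-not-reversed (suc (suc g)) a eq₁ eq₂ = walk-not-reversed g (suc a) eq₁′ eq₂′
      where
      eq₁′ : X (suc a) ≡ X (suc a + suc g)
      eq₁′ = trans eq₂ (cong X (+-suc a (suc g)))
      eq₀ : X a ≡ X (suc (suc (a + suc g)))
      eq₀ = trans eq₁ (cong X (trans (+-suc a (suc (suc g))) (cong suc (+-suc a (suc g)))))
      eq₂′ : X (suc (suc a)) ≡ X (suc a + g)
      eq₂′ = trans (cong₂ other eq₁′ eq₀) (trans (sym (walk-back (a + suc g))) (cong X (+-suc a g)))

    walk-injective : ∀ {i j} → i < j → j < p → X i ≢ X j
    walk-injective {i} {j} i<j j<p Xi≡Xj =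
      neither (adj⇒≡⊎≡other (adj-sym (walk-adj c)) (X (suc j)) (subst (λ x → Adj x (X (suc j))) Xj≡Xc+1 (walk-adj j)))
      where
      open ≡-Reasoning
      c = i + proj₁ first-return
      Xj≡Xc+1 : X j ≡ X (suc c)
      Xj≡Xc+1 = trans (sym Xi≡Xj) (sym (walk-before i))
      j+[c∸j]≡c : j + (c ∸ j) ≡ c
      j+[c∸j]≡c = m+[n∸m]≡n (≤-trans (≤-pred j<p) (m≤n+m _ i))
      neither : X (suc j) ≡ X c ⊎ X (suc j) ≡ X (suc (suc c)) → ⊥
      neither (inj₁ Xj+1≡Xc) = walk-not-reversed (c ∸ j) j
        (trans Xj≡Xc+1 (cong X (sym (trans (+-suc j (c ∸ j)) (cong suc j+[c∸j]≡c)))))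
        (trans Xj+1≡Xc (cong X (sym j+[c∸j]≡c)))
      neither (inj₂ Xj+1≡Xc+2) = dart-injective i<j j<p (sym (begin
        D j       ≡⟨ cong₂ _,_ Xj≡Xc+1 Xj+1≡Xc+2 ⟩
        D (suc c) ≡⟨ cong D (sym (+-suc i _)) ⟩
        D (i + p) ≡⟨ dart-period i ⟩
        D i ∎))

    p≤S : p ≤ S
    p≤S with p ≤? S
    ... | yes p≤S = p≤S
    ... | no p≰S with pigeonhole (≰⇒> p≰S) (λ (t : Fin p) → index (X (toℕ t)))
    ...   | i , j , i<j , eq = ⊥-elim (walk-injective i<j (toℕ<n j) (index-injective eq))

    InOrbit : V → Set
    InOrbit v = ∃ λ i → X i ≡ v

    orbit-closed : ∀ {w v} → InOrbit w → Adj w v → InOrbit v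
    orbit-closed {w} {v} (i , refl) wv =
      landing (adj⇒≡⊎≡other (adj-sym (walk-adj c)) v (subst (λ x → Adj x v) (sym (walk-before i)) wv))
      where
      c = i + proj₁ first-return
      landing : v ≡ X c ⊎ v ≡ X (suc (suc c)) → InOrbit v
      landing (inj₁ v≡Xc) = c , sym v≡Xc
      landing (inj₂ v≡Xc+2) = suc (suc c) , sym v≡Xc+2

    orbit-within-period : ∀ {v} → InOrbit v → ∃ λ j → j < p × X j ≡ v
    orbit-within-period {v} (i , Xi≡v) = i % p , m%n<n i p ,
      trans (sym (walk-period-* (i % p) (i / p))) (trans (cong X (sym (m≡m%n+[m/n]*n i p))) Xi≡v)

    reach-along : ∀ a t → reach F t (X a) (X (a + t)) ≡ true
    reach-along a zero = subst (λ i → (X a == X i) ≡ true) (sym (+-identityʳ a)) (==-refl (X a))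
    reach-along a (suc t) = subst (λ i → reach F (suc t) (X a) (X i) ≡ true) (sym (+-suc a t))
      (trans (cong (reach F t (X a) (X (suc (a + t))) ∨_)
        (any-intro (λ w → reach F t (X a) w ∧ F w (X (suc (a + t)))) (vertices k) (vertices-complete (X (a + t)))
          (cong₂ _∧_ (reach-along a t) (walk-adj (a + t)))))
        (∨-zeroʳ _))

    connected⇒within-period : ∀ {v} → connected F u v ≡ true → ∃ λ j → j < p × X j ≡ v
    connected⇒within-period uv = orbit-within-period (reach-closed InOrbit orbit-closed S (0 , refl) uv)

    within-period⇒connected : ∀ {j} → j < p → connected F u (X j) ≡ true
    within-period⇒connected {j} j<p = reach-mono (≤-trans (<⇒≤ j<p) p≤S) (reach-along 0 j)

    within-period⇒connected-back : ∀ {j} → j < p → connected F (X j) u ≡ true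
    within-period⇒connected-back {j} j<p = reach-mono (≤-trans (m∸n≤m p j) p≤S)
      (subst (λ v → reach F (p ∸ j) (X j) v ≡ true) (trans (cong X (m+[n∸m]≡n (<⇒≤ j<p))) (walk-period 0))
        (reach-along j (p ∸ j)))

    visited : ℕ → V → Bool
    visited zero v = false
    visited (suc q) v = visited q v ∨ (X q == v)

    visited⇒walk : ∀ q {v} → visited q v ≡ true → ∃ λ i → i < q × X i ≡ v
    visited⇒walk (suc q) {v} qv with visited q v in qv′
    ... | true with visited⇒walk q qv′
    ...   | i , i<q , Xi≡v = i , m≤n⇒m≤1+n i<q , Xi≡v
    visited⇒walk (suc q) {v} qv | false = q , ≤-refl , ==-≡ qv

    walk⇒visited : ∀ q {i} → i < q → visited q (X i) ≡ true
    walk⇒visited (suc q) {i} i<1+q with i ≟ q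
    ... | yes refl = trans (cong (visited i (X i) ∨_) (==-refl (X i))) (∨-zeroʳ _)
    ... | no i≢q rewrite walk⇒visited q (≤∧≢⇒< (≤-pred i<1+q) i≢q) = refl

    ∑-visited : ∀ q (g : V → ℕ) → q ≤ p → ∑< q (g ∘ X) ≡ ∑V (λ v → [ visited q v ]· g v)
    ∑-visited zero g _ = sym (trans (∑V-cong {g = λ _ → 0} (λ _ → refl)) (trans (sum-const S 0) (*-zeroʳ S)))
    ∑-visited (suc q) g 1+q≤p = begin
      ∑< (suc q) (g ∘ X)                                  ≡⟨ ∑<-suc-last q (g ∘ X) ⟩
      ∑< q (g ∘ X) + g (X q)                              ≡⟨ cong₂ _+_ (∑-visited q g (≤-trans (n≤1+n q) 1+q≤p)) (sym (∑V-pick (X q) g)) ⟩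
      ∑V (λ v → [ visited q v ]· g v) + ∑V (λ v → [ X q == v ]· g v)
                                                          ≡⟨ sym (∑V-distrib-+ (λ v → [ visited q v ]· g v) (λ v → [ X q == v ]· g v)) ⟩
      ∑V (λ v → [ visited q v ]· g v + [ X q == v ]· g v) ≡⟨ ∑V-cong disjoint ⟩
      ∑V (λ v → [ visited (suc q) v ]· g v) ∎
      where
      open ≡-Reasoning
      disjoint : ∀ v → [ visited q v ]· g v + [ X q == v ]· g v ≡ [ visited q v ∨ (X q == v) ]· g v
      disjoint v with visited q v in qv | X q ≟ᵛ v
      ... | true | yes refl with visited⇒walk q qv
      ...   | i , i<q , Xi≡Xq = ⊥-elim (walk-injective i<q 1+q≤p Xi≡Xq)
      disjoint v | true | no _ = +-identityʳ (g v)
      disjoint v | false | yes _ = refl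
      disjoint v | false | no _ = refl

    visited-period : ∀ v → visited p v ≡ connected F u v
    visited-period v = Bool-ext
      (λ pv → let (i , i<p , Xi≡v) = visited⇒walk p pv in
              subst (λ w → connected F u w ≡ true) Xi≡v (within-period⇒connected i<p))
      (λ uv → let (j , j<p , Xj≡v) = connected⇒within-period uv in
              subst (λ w → visited p w ≡ true) Xj≡v (walk⇒visited p j<p))

    ∑-cycle : (g : V → ℕ) → ∑< p (g ∘ X) ≡ ∑V (λ v → [ connected F u v ]· g v)
    ∑-cycle g = trans (∑-visited p g ≤-refl) (∑V-cong (λ v → cong (λ b → [ b ]· g v) (visited-period v)))

    compSize≡period : compSize F u ≡ p
    compSize≡period = trans (length-filterᵇ-vertices (connected F u))
      (trans (sym (∑-cycle (λ _ → 1))) (trans (sum-const p 1) (*-identityʳ p)))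

  connected-refl : ∀ u → connected F u u ≡ true
  connected-refl u = Cycle.within-period⇒connected u (s≤s z≤n)

  connected-sym : ∀ {u v} → connected F u v ≡ true → connected F v u ≡ true
  connected-sym {u} uv with Cycle.connected⇒within-period u uv
  ... | j , j<p , refl = Cycle.within-period⇒connected-back u j<p

  connected-trans : ∀ {u v w} → connected F u v ≡ true → connected F v w ≡ true → connected F u w ≡ true
  connected-trans {u} {v} {w} uv vw with Cycle.connected⇒within-period u uv
  ... | j , _ , Xj≡v with Cycle.orbit-within-period u (reach-closed (Cycle.InOrbit u) (Cycle.orbit-closed u) S (j , Xj≡v) vw)
  ...   | i , i<p , refl = Cycle.within-period⇒connected u i<p

  ∑ᶜ : (V → ℕ) → V → ℕ
  ∑ᶜ g u = ∑V (λ v → [ connected F u v ]· g v)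

  crossingDegree : V → ℕ
  crossingDegree v = ∑V (λ w → [ F v w ]· crossing v w)

  module CycleCrossings (u : V) where
    open Cycle u

    crossingAt : ℕ → ℕ
    crossingAt i = crossing (X i) (X (suc i))

    crossings : ℕ
    crossings = ∑< p crossingAt

    ∑ᶜ-crossingDegree : ∑ᶜ crossingDegree u ≡ 2 * crossings
    ∑ᶜ-crossingDegree = begin
      ∑ᶜ crossingDegree u                           ≡⟨ sym (∑-cycle crossingDegree) ⟩
      ∑< p (crossingDegree ∘ X)                     ≡⟨ ∑<-rotate p (crossingDegree ∘ X) (cong crossingDegree (walk-period 0)) ⟩
      ∑< p (λ i → crossingDegree (X (suc i)))       ≡⟨ ∑<-cong p both-edges ⟩
      ∑< p (λ i → crossingAt i + crossingAt (suc i)) ≡⟨ ∑-distrib-+ {p} (crossingAt ∘ toℕ) (crossingAt ∘ suc ∘ toℕ) ⟩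
      crossings + ∑< p (crossingAt ∘ suc)           ≡⟨ cong (crossings +_) (sym (∑<-rotate p crossingAt
                                                         (cong₂ crossing (walk-period 0) (walk-period 1)))) ⟩
      crossings + crossings                         ≡⟨ cong (crossings +_) (sym (+-identityʳ crossings)) ⟩
      2 * crossings ∎
      where
      open ≡-Reasoning
      both-edges : ∀ i → crossingDegree (X (suc i)) ≡ crossingAt i + crossingAt (suc i)
      both-edges i = trans (∑-neighbours (adj-sym (walk-adj i)) (crossing (X (suc i))))
        (cong (_+ crossingAt (suc i)) (crossing-sym (X (suc i)) (X i)))

    parity-telescope : (∀ i → ∃ λ x → X i ≡ just x) →
                       ∀ j → (∑< j crossingAt + parity (X 0)) % 2 ≡ parity (X j)
    parity-telescope finite zero = parity-%2 (X 0)
    parity-telescope finite (suc j) = begin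
      (∑< (suc j) crossingAt + P 0) % 2                      ≡⟨ cong (λ s → (s + P 0) % 2) (∑<-suc-last j crossingAt) ⟩
      (∑< j crossingAt + crossingAt j + P 0) % 2             ≡⟨ cong (_% 2) (+-comm-middle (∑< j crossingAt) (crossingAt j) (P 0)) ⟩
      (∑< j crossingAt + P 0 + crossingAt j) % 2             ≡⟨ sym (%-absorbˡ (∑< j crossingAt + P 0) (crossingAt j) 2) ⟩
      ((∑< j crossingAt + P 0) % 2 + crossingAt j) % 2       ≡⟨ cong₂ (λ a b → (a + b) % 2) (parity-telescope finite j) (crossing-parities j) ⟩
      (P j + (P j + P (suc j)) % 2) % 2                     ≡⟨ %-absorbʳ (P j) (P j + P (suc j)) 2 ⟩
      (P j + (P j + P (suc j))) % 2                         ≡⟨ cong (_% 2) (sym (+-assoc (P j) (P j) (P (suc j)))) ⟩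
      (P j + P j + P (suc j)) % 2                           ≡⟨ [m+m+n]%2≡n%2 (P j) (P (suc j)) ⟩
      P (suc j) % 2                                         ≡⟨ parity-%2 (X (suc j)) ⟩
      P (suc j) ∎
      where
      open ≡-Reasoning
      P : ℕ → ℕ
      P i = parity (X i)
      +-comm-middle : ∀ a b c → a + b + c ≡ a + c + b
      +-comm-middle a b c = trans (+-assoc a b c) (trans (cong (a +_) (+-comm b c)) (sym (+-assoc a c b)))
      crossing-parities : ∀ i → crossingAt i ≡ (P i + P (suc i)) % 2
      crossing-parities i with finite i | finite (suc i)
      ... | x , Xi≡x | y , Xi+1≡y = subst₂ (λ v w → crossing v w ≡ (parity v + parity w) % 2)
                                      (sym Xi≡x) (sym Xi+1≡y) (crossing-just x y)

module Components (k : ℕ) (F : Graph k) (simple : IsSimple F) (deg≡2 : ∀ v → degree F v ≡ 2) where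

  open Vertices k
  open TwoRegular k F simple deg≡2

  rank-injective : ∀ {v w : V} → rank v ≡ rank w → v ≡ w
  rank-injective {nothing} {nothing} _ = refl
  rank-injective {just x} {just y} eq = cong just (toℕ-injective (suc-injective eq))

  isRep⇒rank-≤ : ∀ {v w} → isRep F v ≡ true → connected F v w ≡ true → rank v ≤ rank w
  isRep⇒rank-≤ {v} {w} rv vw = from-test (all-elim (λ w → not (connected F v w) ∨ ⌊ rank v ≤? rank w ⌋) (vertices k) rv (vertices-complete w))
    where
    from-test : not (connected F v w) ∨ ⌊ rank v ≤? rank w ⌋ ≡ true → rank v ≤ rank w
    from-test test with connected F v w | rank v ≤? rank w
    ... | _ | yes rv≤rw = rv≤rw
    ... | false | no _ = ⊥-elim (true≢false (sym vw))
    from-test () | true | no _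

  ¬isRep⇒smaller : ∀ {v} → isRep F v ≡ false → ∃ λ w → connected F v w ≡ true × rank w < rank v
  ¬isRep⇒smaller {v} ¬rv with all-counterexample (λ w → not (connected F v w) ∨ ⌊ rank v ≤? rank w ⌋) (vertices k) ¬rv
  ... | w , fails = w , witness fails
    where
    witness : not (connected F v w) ∨ ⌊ rank v ≤? rank w ⌋ ≡ false → connected F v w ≡ true × rank w < rank v
    witness fails′ with connected F v w | rank v ≤? rank w
    witness () | false | _
    witness () | true | yes _
    witness _ | true | no rv≰rw = refl , ≰⇒> rv≰rw

  isRep-∞ : isRep F ∞ ≡ true
  isRep-∞ = all-intro (λ w → not (connected F ∞ w) ∨ ⌊ 0 ≤? rank w ⌋) (vertices k) (λ w → ∨-zeroʳ _)

  Rep : V → Set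
  Rep v = ∃ λ u → isRep F u ≡ true × connected F u v ≡ true

  rep-exists : ∀ v → Rep v
  rep-exists v = <-rec (λ r → ∀ w → rank w ≡ r → connected F w v ≡ true → Rep v) descend (rank v) v refl (connected-refl v)
    where
    descend : ∀ r → (∀ {r′} → r′ < r → ∀ w → rank w ≡ r′ → connected F w v ≡ true → Rep v) →
              ∀ w → rank w ≡ r → connected F w v ≡ true → Rep v
    descend r smaller w refl wv with isRep F w in rw
    ... | true = w , rw , wv
    ... | false with ¬isRep⇒smaller rw
    ...   | w′ , ww′ , w′<w = smaller w′<w w′ refl (connected-trans (connected-sym ww′) wv)

  rep : V → V
  rep v = proj₁ (rep-exists v)

  rep-isRep : ∀ v → isRep F (rep v) ≡ true
  rep-isRep v = proj₁ (proj₂ (rep-exists v))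

  rep-connected : ∀ v → connected F (rep v) v ≡ true
  rep-connected v = proj₂ (proj₂ (rep-exists v))

  rep-unique : ∀ {u v} → isRep F u ≡ true → connected F u v ≡ true → rep v ≡ u
  rep-unique {u} {v} ru uv = rank-injective (≤-antisym
    (isRep⇒rank-≤ (rep-isRep v) (connected-trans (rep-connected v) (connected-sym uv)))
    (isRep⇒rank-≤ ru (connected-trans uv (connected-sym (rep-connected v)))))

  ∑V-components : ∀ g → ∑V g ≡ ∑V (λ u → [ isRep F u ]· ∑ᶜ g u)
  ∑V-components g = begin
    ∑V g                                                     ≡⟨ ∑V-cong (λ v → sym (one-rep v)) ⟩
    ∑V (λ v → ∑V (λ u → [ isRep F u ∧ connected F u v ]· g v)) ≡⟨ ∑V-comm (λ v u → [ isRep F u ∧ connected F u v ]· g v) ⟩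
    ∑V (λ u → ∑V (λ v → [ isRep F u ∧ connected F u v ]· g v)) ≡⟨ ∑V-cong factor ⟩
    ∑V (λ u → [ isRep F u ]· ∑ᶜ g u) ∎
    where
    open ≡-Reasoning
    one-rep : ∀ v → ∑V (λ u → [ isRep F u ∧ connected F u v ]· g v) ≡ g v
    one-rep v = trans (∑V-cong only-rep) (∑V-pick (rep v) (λ _ → g v))
      where
      only-rep : ∀ u → [ isRep F u ∧ connected F u v ]· g v ≡ [ rep v == u ]· g v
      only-rep u with isRep F u in ru | connected F u v in uv | rep v ≟ᵛ u
      ... | true | true | yes _ = refl
      ... | true | true | no rv≢u = ⊥-elim (rv≢u (rep-unique ru uv))
      ... | true | false | yes refl = ⊥-elim (true≢false (trans (sym (rep-connected v)) uv))
      ... | false | _ | yes refl = ⊥-elim (true≢false (trans (sym (rep-isRep v)) ru))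
      ... | true | false | no _ = refl
      ... | false | _ | no _ = refl
    factor : ∀ u → ∑V (λ v → [ isRep F u ∧ connected F u v ]· g v) ≡ [ isRep F u ]· ∑ᶜ g u
    factor u with isRep F u
    ... | true = refl
    ... | false = trans (sum-const S 0) (*-zeroʳ S)

module ShiftInvariant (k : ℕ) (F : Graph k) (simple : IsSimple F) (deg≡2 : ∀ v → degree F v ≡ 2)
  (F-σ : (x y : Vtx k) → F (shiftV (suc k) x) (shiftV (suc k) y) ≡ F x y) where

  open Vertices k
  open TwoRegular k F simple deg≡2
  open Residues k

  σV : V → V
  σV = shiftV n

  σV-involutive : ∀ v → σV (σV v) ≡ v
  σV-involutive nothing = refl
  σV-involutive (just x) = cong just (σ-involutive x)

  σV-injective : ∀ {v w} → σV v ≡ σV w → v ≡ w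
  σV-injective {v} {w} eq = trans (sym (σV-involutive v)) (trans (cong σV eq) (σV-involutive w))

  σV-just≢just : ∀ x → σV (just x) ≢ just x
  σV-just≢just x eq = σx≢x x (just-injective eq)

  ∑V-σV : (g : V → ℕ) → ∑V (g ∘ σV) ≡ ∑V g
  ∑V-σV = ∑V-involution-invariant σV σV-involutive

  adj-σV : ∀ {v w} → Adj v w → Adj (σV v) (σV w)
  adj-σV {v} {w} vw = trans (F-σ v w) vw

  other-σV : ∀ {v a} → Adj v a → σV (other v a) ≡ other (σV v) (σV a)
  other-σV va = adj≢⇒other (adj-σV va) _ (adj-σV (other-adj va)) (other≢ va ∘ σV-injective)

  ==-σV : ∀ v w → (σV v == σV w) ≡ (v == w)
  ==-σV v w = Bool-ext (λ eq → ≡⇒== (σV-injective (==-≡ eq))) (λ eq → ≡⇒== (cong σV (==-≡ eq)))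
    where
    ≡⇒== : ∀ {v w} → v ≡ w → (v == w) ≡ true
    ≡⇒== {v} refl = ==-refl v

  any-σV : (P : V → Bool) → any P (vertices k) ≡ any (P ∘ σV) (vertices k)
  any-σV P = Bool-ext
    (λ anyP → let (w , Pw) = any-elim P (vertices k) anyP in
              any-intro (P ∘ σV) (vertices k) (vertices-complete (σV w)) (trans (cong P (σV-involutive w)) Pw))
    (λ anyPσ → let (w , Pσw) = any-elim (P ∘ σV) (vertices k) anyPσ in
               any-intro P (vertices k) (vertices-complete (σV w)) Pσw)

  any-cong : ∀ {f g : V → Bool} xs → (∀ w → f w ≡ g w) → any f xs ≡ any g xs
  any-cong [] _ = refl
  any-cong (y ∷ xs) f≗g = cong₂ _∨_ (f≗g y) (any-cong xs f≗g)

  reach-σV : ∀ t a b → reach F t (σV a) (σV b) ≡ reach F t a b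
  reach-σV zero a b = ==-σV a b
  reach-σV (suc t) a b = cong₂ _∨_ (reach-σV t a b)
    (trans (any-σV (λ w → reach F t (σV a) w ∧ F w (σV b)))
           (any-cong (vertices k) (λ w → cong₂ _∧_ (reach-σV t a w) (F-σ w b))))

  connected-σV : ∀ a b → connected F (σV a) (σV b) ≡ connected F a b
  connected-σV = reach-σV S

  ∑ᶜ-σV : (g : V → ℕ) → (∀ v → g (σV v) ≡ g v) → ∀ u → ∑ᶜ g (σV u) ≡ ∑ᶜ g u
  ∑ᶜ-σV g g∘σV u = trans (sym (∑V-σV (λ v → [ connected F (σV u) v ]· g v)))
    (∑V-cong (λ v → cong₂ [_]·_ (connected-σV u v) (g∘σV v)))

  ∑ᶜ-connected : (g : V → ℕ) → ∀ {u u′} → connected F u u′ ≡ true → ∑ᶜ g u ≡ ∑ᶜ g u′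
  ∑ᶜ-connected g {u} {u′} uu′ = ∑V-cong (λ v → cong (λ b → [ b ]· g v)
    (Bool-ext (connected-trans (connected-sym uu′)) (connected-trans {v = u′} {w = v} uu′)))

  crossingDegree-σV : ∀ v → crossingDegree (σV v) ≡ crossingDegree v
  crossingDegree-σV v = trans (sym (∑V-σV (λ w → [ F (σV v) w ]· crossing (σV v) w)))
    (∑V-cong (λ w → cong₂ [_]·_ (F-σ v w) (crossing-σ v w)))

  compSize≡∑ᶜ : ∀ u → compSize F u ≡ ∑ᶜ (λ _ → 1) u
  compSize≡∑ᶜ u = length-filterᵇ-vertices (connected F u)

module Differences (k : ℕ) (F : Graph k) (simple : IsSimple F) (deg≡2 : ∀ v → degree F v ≡ 2)
  (F-σ : (x y : Vtx k) → F (shiftV (suc k) x) (shiftV (suc k) y) ≡ F x y)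
  (covers : (d : Zn k) → toℕ d ≢ 0 → ∃₂ λ (x y : Zn k) → (F (just x) (just y) ≡ true) × (x ⊖ y ≡ d)) where

  open Vertices k
  open TwoRegular k F simple deg≡2
  open ShiftInvariant k F simple deg≡2 F-σ
  open Residues k

  A : Zn k → Zn k → Bool
  A x y = F (just x) (just y)

  count : Zn k → Zn k → ℕ
  count d x = sum (λ y → [ (x ⊖ y) ≟ᵇ d ]· [ A x y ]· 1)

  N : Zn k → ℕ
  N d = sum (count d)

  count-σ : ∀ d x → count d (σ x) ≡ count d x
  count-σ d x = trans (sym (sum-involution-invariant σ σ-involutive (λ y → [ (σ x ⊖ y) ≟ᵇ d ]· [ A (σ x) y ]· 1)))
    (sum-cong-≗ (λ y → cong₂ (λ e b → [ e ≟ᵇ d ]· [ b ]· 1) (⊖-σ x y) (F-σ (just x) (just y))))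

  N-even : ∀ d → ∃ λ t → N d ≡ 2 * t
  N-even d = sum (λ x → [ x <ᶠᵇ σ x ]· count d x) , trans (sum-involution σ σ-involutive (count d) (count-σ d))
    (cong (_+ 2 * sum (λ x → [ x <ᶠᵇ σ x ]· count d x)) (trans (sum-cong-≗ no-fixed-point) (sum-replicate-zero M)))
    where
    no-fixed-point : ∀ x → [ x ≟ᵇ σ x ]· count d x ≡ 0
    no-fixed-point x with x ≟ᶠ σ x
    ... | yes x≡σx = ⊥-elim (σx≢x x (sym x≡σx))
    ... | no _ = refl

  N-positive : ∀ d → toℕ d ≢ 0 → 1 ≤ N d
  N-positive d d≢0 with covers d d≢0
  ... | x , y , xy , x⊖y≡d = ≤-trans (≤-reflexive (sym hit)) (≤-trans (sum-point (λ y → [ (x ⊖ y) ≟ᵇ d ]· [ A x y ]· 1) y) (sum-point (count d) x))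
    where
    hit : [ (x ⊖ y) ≟ᵇ d ]· [ A x y ]· 1 ≡ 1
    hit rewrite x⊖y≡d | xy | ≟ᵇ-refl d = refl

  N≥2 : ∀ d → toℕ d ≢ 0 → 2 ≤ N d
  N≥2 d d≢0 = even-positive⇒≥2 (proj₁ (N-even d)) (proj₂ (N-even d)) (N-positive d d≢0)

  degree-just : ∀ x → [ F (just x) ∞ ]· 1 + sum (λ y → [ A x y ]· 1) ≡ 2
  degree-just x = trans (sym (length-filterᵇ-vertices (F (just x)))) (deg≡2 (just x))

  degree-∞ : sum (λ x → [ F ∞ (just x) ]· 1) ≡ 2
  degree-∞ = trans (cong (λ b → [ b ]· 1 + sum (λ x → [ F ∞ (just x) ]· 1)) (sym (proj₂ simple ∞)))
    (trans (sym (length-filterᵇ-vertices (F ∞))) (deg≡2 ∞))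

  ∑-adjacent : sum (λ x → sum (λ y → [ A x y ]· 1)) + 2 ≡ M * 2
  ∑-adjacent = begin
    E + 2                                                  ≡⟨ cong (E +_) (sym (trans (sum-cong-≗ (λ x → cong (λ b → [ b ]· 1) (proj₁ simple (just x) ∞))) degree-∞)) ⟩
    E + sum (λ x → [ F (just x) ∞ ]· 1)                    ≡⟨ +-comm E _ ⟩
    sum (λ x → [ F (just x) ∞ ]· 1) + E                    ≡⟨ sym (∑-distrib-+ (λ x → [ F (just x) ∞ ]· 1) (λ x → sum (λ y → [ A x y ]· 1))) ⟩
    sum (λ x → [ F (just x) ∞ ]· 1 + sum (λ y → [ A x y ]· 1)) ≡⟨ sum-cong-≗ degree-just ⟩
    sum (λ (x : Zn k) → 2)                                 ≡⟨ sum-const M 2 ⟩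
    M * 2 ∎
    where
    open ≡-Reasoning
    E = sum (λ x → sum (λ y → [ A x y ]· 1))

  ∑-N : sum N ≡ sum (λ x → sum (λ y → [ A x y ]· 1))
  ∑-N = begin
    sum (λ d → sum (λ x → sum (λ y → w x y d))) ≡⟨ ∑-comm (λ d x → sum (λ y → w x y d)) ⟩
    sum (λ x → sum (λ d → sum (λ y → w x y d))) ≡⟨ sum-cong-≗ (λ x → ∑-comm (λ d y → w x y d)) ⟩
    sum (λ x → sum (λ y → sum (λ d → w x y d))) ≡⟨ sum-cong-≗ (λ x → sum-cong-≗ (λ y → sum-pick (x ⊖ y) (λ _ → [ A x y ]· 1))) ⟩
    sum (λ x → sum (λ y → [ A x y ]· 1)) ∎
    where
    open ≡-Reasoning
    w : Zn k → Zn k → Zn k → ℕ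
    w x y d = [ (x ⊖ y) ≟ᵇ d ]· [ A x y ]· 1

  N-zero : N zero ≡ 0
  N-zero = trans (sum-cong-≗ (λ x → trans (sum-cong-≗ (no-loop x)) (sum-replicate-zero M))) (sum-replicate-zero M)
    where
    no-loop : ∀ x y → [ (x ⊖ y) ≟ᵇ zero ]· [ A x y ]· 1 ≡ 0
    no-loop x y with (x ⊖ y) ≟ᶠ zero
    ... | no _ = refl
    ... | yes x⊖y≡0 rewrite ⊖≡0⇒≡ x y (cong toℕ x⊖y≡0) | proj₂ simple (just y) = refl

  N≡2 : ∀ d → toℕ d ≢ 0 → N d ≡ 2
  N≡2 zero d≢0 = ⊥-elim (d≢0 refl)
  N≡2 (suc d) _ = sum≡m*c⇒≡c (N ∘ suc) 2 (λ i → N≥2 (suc i) (λ ())) total d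
    where
    total : sum (N ∘ suc) ≡ (k + suc (k + 0)) * 2
    total = +-cancelʳ-≡ 2 _ _ (trans (cong (_+ 2) (trans (sym (cong (_+ sum (N ∘ suc)) N-zero)) ∑-N))
      (trans ∑-adjacent (+-comm 2 _)))

  count-half : ∀ x → count half x ≡ [ A x (σ x) ]· 1
  count-half x = trans (sum-cong-≗ only-σx) (sum-pick (σ x) (λ y → [ A x y ]· 1))
    where
    only-σx : ∀ y → [ (x ⊖ y) ≟ᵇ half ]· [ A x y ]· 1 ≡ [ σ x ≟ᵇ y ]· [ A x y ]· 1
    only-σx y with (x ⊖ y) ≟ᶠ half | σ x ≟ᶠ y
    ... | yes _ | yes _ = refl
    ... | no _ | no _ = refl
    ... | yes x⊖y≡half | no σx≢y = ⊥-elim (σx≢y (sym (⊖≡half⇒σ x y x⊖y≡half)))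
    ... | no x⊖y≢half | yes refl = ⊥-elim (x⊖y≢half (x⊖σx≡half x))

  half≢0 : toℕ half ≢ 0
  half≢0 half≡0 = 0≢1+n (trans (sym half≡0) toℕ-half)

  diagonal-edges : ∀ z w → A z (σ z) ≡ true → A w (σ w) ≡ true → w ≡ z ⊎ w ≡ σ z
  diagonal-edges z w zσz wσw with w ≟ᶠ z | w ≟ᶠ σ z
  ... | yes w≡z | _ = inj₁ w≡z
  ... | no _ | yes w≡σz = inj₂ w≡σz
  ... | no w≢z | no w≢σz = ⊥-elim (1+n≰n (begin
    3                   ≡⟨ sym (cong₂ _+_ (cong₂ _+_ (hit zσz) (hit σzz)) (hit wσw)) ⟩
    f z + f (σ z) + f w ≤⟨ sum-three f (σx≢x z ∘ sym) (w≢z ∘ sym) (w≢σz ∘ sym) ⟩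
    sum f               ≡⟨ sym (sum-cong-≗ count-half) ⟩
    N half              ≡⟨ N≡2 half half≢0 ⟩
    2 ∎))
    where
    open ≤-Reasoning
    f : Zn k → ℕ
    f x = [ A x (σ x) ]· 1
    hit : ∀ {x} → A x (σ x) ≡ true → f x ≡ 1
    hit xσx = cong (λ b → [ b ]· 1) xσx
    σzz : A (σ z) (σ (σ z)) ≡ true
    σzz = trans (cong (A (σ z)) (σ-involutive z)) (trans (proj₁ simple (just (σ z)) (just z)) zσz)

  crossingDegree-just : ∀ x → crossingDegree (just x) ≡ sum (λ y → [ A x y ]· (toℕ (x ⊖ y) % 2))
  crossingDegree-just x = trans (cong (_+ sum (λ y → [ A x y ]· ((toℕ x + toℕ y) % 2))) ([]·-zeroʳ (F (just x) ∞)))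
    (sum-cong-≗ (λ y → cong ([ A x y ]·_) (sym (⊖-parity x y))))

  ∑-crossingDegree : ∑V crossingDegree ≡ 2 * n
  ∑-crossingDegree = begin
    crossingDegree ∞ + sum (crossingDegree ∘ just)
      ≡⟨ cong₂ _+_ (trans (∑V-cong (λ w → []·-zeroʳ (F ∞ w))) (sum-replicate-zero S)) (sum-cong-≗ crossingDegree-just) ⟩
    sum (λ x → sum (λ y → [ A x y ]· (toℕ (x ⊖ y) % 2)))
      ≡⟨ sum-cong-≗ (λ x → sum-cong-≗ (λ y → sym (sum-pick (x ⊖ y) (λ d → [ A x y ]· (toℕ d % 2))))) ⟩
    sum (λ x → sum (λ y → sum (λ d → w d x y)))
      ≡⟨ sum-cong-≗ (λ x → ∑-comm (λ y d → w d x y)) ⟩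
    sum (λ x → sum (λ d → sum (λ y → w d x y)))
      ≡⟨ ∑-comm (λ x d → sum (λ y → w d x y)) ⟩
    sum (λ d → sum (λ x → sum (λ y → w d x y)))
      ≡⟨ sum-cong-≗ weigh ⟩
    sum (λ (d : Zn k) → 2 * (toℕ d % 2))
      ≡⟨ sym (*-distribˡ-sum 2 (λ (d : Zn k) → toℕ d % 2)) ⟩
    2 * sum (λ (d : Zn k) → toℕ d % 2)
      ≡⟨ cong (2 *_) ∑-parity ⟩
    2 * n ∎
    where
    open ≡-Reasoning
    w : Zn k → Zn k → Zn k → ℕ
    w d x y = [ (x ⊖ y) ≟ᵇ d ]· [ A x y ]· (toℕ d % 2)
    factor : ∀ b a c → [ b ]· [ a ]· c ≡ c * [ b ]· [ a ]· 1
    factor false a c = sym (*-zeroʳ c)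
    factor true a c = []·-comm-* a c
    weigh : ∀ d → sum (λ x → sum (λ y → w d x y)) ≡ 2 * (toℕ d % 2)
    weigh d = begin
      sum (λ x → sum (λ y → w d x y))                          ≡⟨ sum-cong-≗ (λ x → sum-cong-≗ (λ y → factor ((x ⊖ y) ≟ᵇ d) (A x y) (toℕ d % 2))) ⟩
      sum (λ x → sum (λ y → toℕ d % 2 * [ (x ⊖ y) ≟ᵇ d ]· [ A x y ]· 1))
                                                               ≡⟨ sum-cong-≗ (λ x → sym (*-distribˡ-sum (toℕ d % 2) (λ y → [ (x ⊖ y) ≟ᵇ d ]· [ A x y ]· 1))) ⟩
      sum (λ x → toℕ d % 2 * count d x)                        ≡⟨ sym (*-distribˡ-sum (toℕ d % 2) (count d)) ⟩
      toℕ d % 2 * N d                                          ≡⟨ parity-weight d ⟩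
      2 * (toℕ d % 2) ∎
      where
      parity-weight : ∀ d → toℕ d % 2 * N d ≡ 2 * (toℕ d % 2)
      parity-weight zero = refl
      parity-weight (suc d) = trans (cong (toℕ (suc d) % 2 *_) (N≡2 (suc d) (λ ()))) (*-comm (toℕ (suc d) % 2) 2)

module ComponentPairing (k : ℕ) (F : Graph k) (simple : IsSimple F) (deg≡2 : ∀ v → degree F v ≡ 2)
  (F-σ : (x y : Vtx k) → F (shiftV (suc k) x) (shiftV (suc k) y) ≡ F x y) where

  open Vertices k
  open TwoRegular k F simple deg≡2
  open Components k F simple deg≡2
  open ShiftInvariant k F simple deg≡2 F-σ

  partnerOf : Bool → V → V
  partnerOf true u = rep (σV u)
  partnerOf false u = u

  partner : V → V
  partner u = partnerOf (isRep F u) u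

  partner-rep : ∀ {u} → isRep F u ≡ true → partner u ≡ rep (σV u)
  partner-rep {u} ru = cong (λ b → partnerOf b u) ru

  partner-nonrep : ∀ {u} → isRep F u ≡ false → partner u ≡ u
  partner-nonrep {u} ¬ru = cong (λ b → partnerOf b u) ¬ru

  partner-involutive : ∀ u → partner (partner u) ≡ u
  partner-involutive u with isRep F u in ru
  ... | false = partner-nonrep ru
  ... | true = trans (partner-rep (rep-isRep (σV u))) (rep-unique ru u↝σw)
    where
    w = rep (σV u)
    u↝σw : connected F u (σV w) ≡ true
    u↝σw = connected-sym (trans (cong (connected F (σV w)) (sym (σV-involutive u)))
                                (trans (connected-σV w (σV u)) (rep-connected (σV u))))

  fixedRep : V → Bool
  fixedRep u = isRep F u ∧ connected F u (σV u)

  partner-fixed : ∀ u → (u == partner u) ∧ isRep F u ≡ fixedRep u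
  partner-fixed u with isRep F u in ru
  ... | false = ∧-zeroʳ (u == u)
  ... | true = trans (∧-identityʳ (u == rep (σV u))) (Bool-ext fixed⇒connected connected⇒fixed)
    where
    fixed⇒connected : (u == rep (σV u)) ≡ true → connected F u (σV u) ≡ true
    fixed⇒connected u≡r = subst (λ v → connected F v (σV u) ≡ true) (sym (==-≡ u≡r)) (rep-connected (σV u))
    connected⇒fixed : connected F u (σV u) ≡ true → (u == rep (σV u)) ≡ true
    connected⇒fixed uσu = subst (λ v → (u == v) ≡ true) (sym (rep-unique ru uσu)) (==-refl u)

  partner-∞ : partner ∞ ≡ ∞
  partner-∞ = trans (partner-rep isRep-∞) (rep-unique isRep-∞ (connected-refl ∞))

  module Weighted (κ : V → ℕ) (κ-σV : ∀ u → κ (σV u) ≡ κ u)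
                  (κ-connected : ∀ {u u′} → connected F u u′ ≡ true → κ u ≡ κ u′) where

    onReps : V → ℕ
    onReps u = [ isRep F u ]· κ u

    onReps-partner : ∀ u → onReps (partner u) ≡ onReps u
    onReps-partner u with isRep F u in ru
    ... | false = cong (λ b → [ b ]· κ u) ru
    ... | true = begin
      [ isRep F w ]· κ w              ≡⟨ cong (λ b → [ b ]· κ w) (rep-isRep (σV u)) ⟩
      κ w                             ≡⟨ κ-connected (rep-connected (σV u)) ⟩
      κ (σV u)                        ≡⟨ κ-σV u ⟩
      κ u ∎
      where
      open ≡-Reasoning
      w = rep (σV u)

    paired : ℕ
    paired = ∑V (λ u → [ index u <ᶠᵇ index (partner u) ]· onReps u)

    ∑-reps : ∑V onReps ≡ κ ∞ + sum (λ x → [ fixedRep (just x) ]· κ (just x)) + 2 * paired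
    ∑-reps = trans (∑V-involution partner partner-involutive onReps onReps-partner)
      (cong (_+ 2 * paired) (trans (∑V-cong fixed)
        (cong (λ b → [ b ]· κ ∞ + sum (λ x → [ fixedRep (just x) ]· κ (just x))) fixed-∞)))
      where
      fixed : ∀ u → [ u == partner u ]· onReps u ≡ [ fixedRep u ]· κ u
      fixed u = trans (sym ([]·-∧ (u == partner u) (isRep F u) (κ u))) (cong (λ b → [ b ]· κ u) (partner-fixed u))
      fixed-∞ : fixedRep ∞ ≡ true
      fixed-∞ = cong₂ _∧_ isRep-∞ (connected-refl ∞)

    paired-∞ : [ index ∞ <ᶠᵇ index (partner ∞) ]· onReps ∞ ≡ 0
    paired-∞ = cong (λ v → [ index ∞ <ᶠᵇ index v ]· onReps ∞) partner-∞

module TriangleAt∞ (k : ℕ) (F : Graph k) (simple : IsSimple F) (deg≡2 : ∀ v → degree F v ≡ 2)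
  (F-σ : (x y : Vtx k) → F (shiftV (suc k) x) (shiftV (suc k) y) ≡ F x y)
  (covers : (d : Zn k) → toℕ d ≢ 0 → ∃₂ λ (x y : Zn k) → (F (just x) (just y) ≡ true) × (x ⊖ y ≡ d))
  (triangle : compSize F ∞ ≡ 3) where

  open Vertices k
  open TwoRegular k F simple deg≡2
  open ShiftInvariant k F simple deg≡2 F-σ
  open Differences k F simple deg≡2 F-σ covers
  open Residues k
  module C∞ = Cycle ∞

  period-∞ : C∞.p ≡ 3
  period-∞ = trans (sym C∞.compSize≡period) triangle

  walk-∞-3 : walk ∞ 3 ≡ ∞
  walk-∞-3 = trans (cong (walk ∞) (sym period-∞)) (C∞.walk-period 0)

  walk-∞-1-finite : ∃ λ z → walk ∞ 1 ≡ just z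
  walk-∞-1-finite with walk ∞ 1 in eq
  ... | nothing = ⊥-elim (adj⇒≢ (C∞.walk-adj 0) (sym eq))
  ... | just z = z , refl

  z₀ : Zn k
  z₀ = proj₁ walk-∞-1-finite

  walk-∞-1 : walk ∞ 1 ≡ just z₀
  walk-∞-1 = proj₂ walk-∞-1-finite

  walk-∞-2 : walk ∞ 2 ≡ just (σ z₀)
  walk-∞-2 = begin
    walk ∞ 2             ≡⟨ adj≢⇒other first-edge (walk ∞ 2) (adj-sym last-edge) walk-2≢walk-1 ⟩
    other ∞ (walk ∞ 1)   ≡⟨ sym (adj≢⇒other first-edge (σV (walk ∞ 1)) (adj-σV first-edge) σ-moves) ⟩
    σV (walk ∞ 1)        ≡⟨ cong σV walk-∞-1 ⟩
    just (σ z₀) ∎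
    where
    open ≡-Reasoning
    first-edge : Adj ∞ (walk ∞ 1)
    first-edge = C∞.walk-adj 0
    last-edge : Adj (walk ∞ 2) ∞
    last-edge = subst (Adj (walk ∞ 2)) walk-∞-3 (C∞.walk-adj 2)
    walk-2≢walk-1 : walk ∞ 2 ≢ walk ∞ 1
    walk-2≢walk-1 eq = C∞.walk-injective (s≤s (s≤s z≤n)) (subst (2 <_) (sym period-∞) ≤-refl) (sym eq)
    σ-moves : σV (walk ∞ 1) ≢ walk ∞ 1
    σ-moves eq = σV-just≢just z₀ (trans (cong σV (sym walk-∞-1)) (trans eq walk-∞-1))

  diagonal-z₀ : A z₀ (σ z₀) ≡ true
  diagonal-z₀ = subst₂ (λ v w → F v w ≡ true) walk-∞-1 walk-∞-2 (C∞.walk-adj 1)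

  connected-∞-z₀ : connected F ∞ (just z₀) ≡ true
  connected-∞-z₀ = subst (λ v → connected F ∞ v ≡ true) walk-∞-1
    (C∞.within-period⇒connected (subst (1 <_) (sym period-∞) (s≤s (s≤s z≤n))))

  connected-∞-σz₀ : connected F ∞ (just (σ z₀)) ≡ true
  connected-∞-σz₀ = subst (λ v → connected F ∞ v ≡ true) walk-∞-2
    (C∞.within-period⇒connected (subst (2 <_) (sym period-∞) ≤-refl))

  ∑ᶜ-crossingDegree-∞ : ∑ᶜ crossingDegree ∞ ≡ 2 * (n % 2)
  ∑ᶜ-crossingDegree-∞ = trans (CycleCrossings.∑ᶜ-crossingDegree ∞) (cong (2 *_) (begin
    ∑< C∞.p crossingAt                         ≡⟨ cong (λ m → ∑< m crossingAt) period-∞ ⟩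
    crossingAt 0 + (crossingAt 1 + (crossingAt 2 + 0)) ≡⟨ cong₂ (λ b c → b + (c + 0)) middle last ⟩
    n % 2 + 0                                  ≡⟨ +-identityʳ (n % 2) ⟩
    n % 2 ∎))
    where
    open ≡-Reasoning
    open CycleCrossings ∞ using (crossingAt)
    middle : crossingAt 1 ≡ n % 2
    middle = trans (cong₂ crossing walk-∞-1 walk-∞-2) (crossing-σ-self z₀)
    last : crossingAt 2 ≡ 0
    last = trans (cong (crossing (walk ∞ 2)) walk-∞-3) (crossing-∞ʳ (walk ∞ 2))

  module AvoidingCycle (u : V) (avoids : connected F u ∞ ≢ true) where
    open Cycle u
    open CycleCrossings u

    walk-connected : ∀ i → connected F u (X i) ≡ true
    walk-connected i with orbit-within-period (i , refl)
    ... | j , j<p , Xj≡Xi = subst (λ v → connected F u v ≡ true) Xj≡Xi (within-period⇒connected j<p)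

    off-triangle : ∀ i {v} → X i ≡ v → connected F ∞ v ≢ true
    off-triangle i refl ∞Xi = avoids (connected-trans (walk-connected i) (connected-sym ∞Xi))

    walk-finite : ∀ i → ∃ λ x → X i ≡ just x
    walk-finite i with X i in Xi≡
    ... | just x = x , refl
    ... | nothing = ⊥-elim (off-triangle i Xi≡ (connected-refl ∞))

    no-diagonal : ∀ i {x} → X i ≡ just x → A x (σ x) ≢ true
    no-diagonal i {x} Xi≡x xσx with diagonal-edges z₀ x diagonal-z₀ xσx
    ... | inj₁ refl = off-triangle i Xi≡x connected-∞-z₀
    ... | inj₂ refl = off-triangle i Xi≡x connected-∞-σz₀

    crossings-even : crossings % 2 ≡ 0
    crossings-even = %2-cancelʳ crossings (parity (X 0)) 0
      (trans (parity-telescope walk-finite p) (trans (cong parity (walk-period 0)) (sym (parity-%2 (X 0)))))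

    ∑ᶜ-crossingDegree-4∣ : ∃ λ t → ∑ᶜ crossingDegree u ≡ 4 * t
    ∑ᶜ-crossingDegree-4∣ with m%n≡0⇒n∣m crossings 2 crossings-even
    ... | divides t crossings≡t*2 = t , trans ∑ᶜ-crossingDegree (trans (cong (2 *_) crossings≡t*2) (2*[t*2]≡4*t t))
      where
      2*[t*2]≡4*t : ∀ t → 2 * (t * 2) ≡ 4 * t
      2*[t*2]≡4*t = solve-∀

    walk-not-σ-reversed : ∀ g a → σV (X a) ≡ X (a + suc g) → σV (X (suc a)) ≡ X (a + g) → ⊥
    walk-not-σ-reversed zero a eq₁ _ with walk-finite a
    ... | x , Xa≡x = no-diagonal a Xa≡x (subst (λ v → F v (σV v) ≡ true) Xa≡x
      (subst (Adj (X a)) (sym (trans eq₁ (cong X (+-comm a 1)))) (walk-adj a)))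
    walk-not-σ-reversed (suc zero) a _ eq₂ with walk-finite (suc a)
    ... | y , Xa+1≡y = σV-just≢just y (trans (cong σV (sym Xa+1≡y)) (trans eq₂ (trans (cong X (+-comm a 1)) Xa+1≡y)))
    walk-not-σ-reversed (suc (suc g)) a eq₁ eq₂ = walk-not-σ-reversed g (suc a) eq₁′ eq₂′
      where
      eq₁′ : σV (X (suc a)) ≡ X (suc a + suc g)
      eq₁′ = trans eq₂ (cong X (+-suc a (suc g)))
      eq₀ : σV (X a) ≡ X (suc (suc (a + suc g)))
      eq₀ = trans eq₁ (cong X (trans (+-suc a (suc (suc g))) (cong suc (+-suc a (suc g)))))
      eq₂′ : σV (X (suc (suc a))) ≡ X (suc a + g)
      eq₂′ = trans (other-σV (adj-sym (walk-adj a)))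
        (trans (cong₂ other eq₁′ eq₀) (trans (sym (walk-back (a + suc g))) (cong X (+-suc a g))))

    module Rotation {j} (1≤j : 1 ≤ j) (j<p : j < p) (Xj≡σu : X j ≡ σV u) (σX1≡Xj+1 : σV (X 1) ≡ X (suc j)) where

      σ-rotates : ∀ i → σV (X i) ≡ X (j + i) × σV (X (suc i)) ≡ X (j + suc i)
      σ-rotates zero = trans (sym Xj≡σu) (cong X (sym (+-identityʳ j))) , trans σX1≡Xj+1 (cong X (sym (+-comm j 1)))
      σ-rotates (suc i) = proj₂ (σ-rotates i) , (begin
        σV (X (suc (suc i)))                        ≡⟨ other-σV (adj-sym (walk-adj i)) ⟩
        other (σV (X (suc i))) (σV (X i))           ≡⟨ cong₂ other (proj₂ (σ-rotates i)) (proj₁ (σ-rotates i)) ⟩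
        other (X (j + suc i)) (X (j + i))           ≡⟨ cong (λ m → other (X m) (X (j + i))) (+-suc j i) ⟩
        X (suc (suc (j + i)))                       ≡⟨ cong X (sym (trans (+-suc j (suc i)) (cong suc (+-suc j i)))) ⟩
        X (j + suc (suc i)) ∎)
        where open ≡-Reasoning

      returns-at-2j : X (j + j) ≡ X 0
      returns-at-2j = trans (sym (proj₁ (σ-rotates j))) (trans (cong σV Xj≡σu) (σV-involutive u))

      period≡2j : p ≡ j + j
      period≡2j with <-cmp (j + j) p
      ... | tri< 2j<p _ _ = ⊥-elim (walk-injective (≤-trans 1≤j (m≤m+n j j)) 2j<p (sym returns-at-2j))
      ... | tri≈ _ 2j≡p _ = sym 2j≡p
      ... | tri> _ _ 2j>p = ⊥-elim (walk-injective (m<n⇒0<n∸m 2j>p) r<p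
              (sym (trans (sym (walk-period r)) (trans (cong X r+p≡2j) returns-at-2j))))
        where
        r = j + j ∸ p
        r+p≡2j : r + p ≡ j + j
        r+p≡2j = m∸n+n≡m (<⇒≤ 2j>p)
        r<p : r < p
        r<p = +-cancelʳ-< p r p (subst (_< p + p) (sym r+p≡2j) (+-mono-< j<p j<p))

      half-crossings : ℕ
      half-crossings = ∑< j crossingAt

      crossings≡2*half : crossings ≡ 2 * half-crossings
      crossings≡2*half = begin
        ∑< p crossingAt                                     ≡⟨ cong (λ m → ∑< m crossingAt) period≡2j ⟩
        ∑< (j + j) crossingAt                               ≡⟨ ∑<-+ j j crossingAt ⟩
        half-crossings + ∑< j (λ i → crossingAt (j + i))    ≡⟨ cong (half-crossings +_) (∑<-cong j σ-image) ⟩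
        half-crossings + half-crossings                     ≡⟨ cong (half-crossings +_) (sym (+-identityʳ _)) ⟩
        2 * half-crossings ∎
        where
        open ≡-Reasoning
        σ-image : ∀ i → crossingAt (j + i) ≡ crossingAt i
        σ-image i = trans (cong₂ crossing (sym (proj₁ (σ-rotates i))) (trans (cong X (sym (+-suc j i))) (sym (proj₂ (σ-rotates i)))))
          (crossing-σ (X i) (X (suc i)))

      half-crossings-parity : half-crossings % 2 ≡ n % 2
      half-crossings-parity with walk-finite 0
      ... | x , u≡x = %2-cancelʳ half-crossings (parity u) n (begin
        (half-crossings + parity (X 0)) % 2   ≡⟨ parity-telescope walk-finite j ⟩
        parity (X j)                          ≡⟨ cong parity (trans Xj≡σu (cong σV u≡x)) ⟩
        toℕ (σ x) % 2                         ≡⟨ σ-parity x ⟩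
        (toℕ x + n) % 2                       ≡⟨ cong (_% 2) (+-comm (toℕ x) n) ⟩
        (n + toℕ x) % 2                       ≡⟨ sym (%-absorbʳ n (toℕ x) 2) ⟩
        (n + parity (just x)) % 2             ≡⟨ cong (λ v → (n + parity v) % 2) (sym u≡x) ⟩
        (n + parity u) % 2 ∎)
        where open ≡-Reasoning

      ∑ᶜ-crossingDegree-σ-invariant : ∃ λ t → ∑ᶜ crossingDegree u ≡ 4 * (n % 2) + 8 * t
      ∑ᶜ-crossingDegree-σ-invariant = half-crossings / 2 , (begin
        ∑ᶜ crossingDegree u                    ≡⟨ ∑ᶜ-crossingDegree ⟩
        2 * crossings                          ≡⟨ cong (2 *_) crossings≡2*half ⟩
        2 * (2 * half-crossings)               ≡⟨ cong (λ h → 2 * (2 * h)) (m≡m%n+[m/n]*n half-crossings 2) ⟩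
        2 * (2 * (H % 2 + H / 2 * 2))          ≡⟨ regroup (H % 2) (H / 2) ⟩
        4 * (H % 2) + 8 * (H / 2)              ≡⟨ cong (λ r → 4 * r + 8 * (H / 2)) half-crossings-parity ⟩
        4 * (n % 2) + 8 * (H / 2) ∎)
        where
        open ≡-Reasoning
        H = half-crossings
        regroup : ∀ a b → 2 * (2 * (a + b * 2)) ≡ 4 * a + 8 * b
        regroup = solve-∀

      compSize-even : isEven (compSize F u) ≡ true
      compSize-even = trans (cong isEven (trans compSize≡period period≡2j)) (double-isEven j)

    σ-invariant-cycle : connected F u (σV u) ≡ true →
      (∃ λ t → ∑ᶜ crossingDegree u ≡ 4 * (n % 2) + 8 * t) × isEven (compSize F u) ≡ true
    σ-invariant-cycle uσu with connected⇒within-period uσu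
    ... | zero , _ , u≡σu with walk-finite 0
    ...   | x , u≡x = ⊥-elim (σV-just≢just x (trans (cong σV (sym u≡x)) (trans (sym u≡σu) u≡x)))
    σ-invariant-cycle uσu | suc j , j<p , Xj+1≡σu
      with adj⇒≡⊎≡other (adj-sym (walk-adj j)) (σV (X 1))
             (subst (λ v → Adj v (σV (X 1))) (sym Xj+1≡σu) (adj-σV (walk-adj 0)))
    ... | inj₁ σX1≡Xj = ⊥-elim (walk-not-σ-reversed j 0 (sym Xj+1≡σu) σX1≡Xj)
    ... | inj₂ σX1≡Xj+2 = ∑ᶜ-crossingDegree-σ-invariant , compSize-even
      where open Rotation (s≤s z≤n) j<p Xj+1≡σu σX1≡Xj+2

parity-count-arithmetic : ∀ k r c a b l →
  2 * suc k ≡ 2 * (suc k % 2) + (4 * (suc k % 2) * c + 8 * a) + 2 * (4 * b) →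
  r ≡ c + 2 * l →
  (suc k % 4 ≡ 0) ⊎ ((suc k % 2 ≡ 1) × ((k / 2 + r) % 2 ≡ 0))
parity-count-arithmetic k r c a b l count r≡c+2l with %2≡0⊎%2≡1 (suc k)
... | inj₁ even = inj₁ (begin
  suc k % 4           ≡⟨ cong (_% 4) (*-cancelˡ-≡ (suc k) (4 * (a + b)) 2 (trans count (trans
                           (cong (λ e → 2 * e + (4 * e * c + 8 * a) + 2 * (4 * b)) even) (regroup a b)))) ⟩
  4 * (a + b) % 4     ≡⟨ cong (_% 4) (*-comm 4 (a + b)) ⟩
  (a + b) * 4 % 4     ≡⟨ m*n%n≡0 (a + b) 4 ⟩
  0 ∎)
  where
  open ≡-Reasoning
  regroup : ∀ a b → 2 * 0 + (4 * 0 * c + 8 * a) + 2 * (4 * b) ≡ 2 * (4 * (a + b))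
  regroup = solve-∀
... | inj₂ odd = inj₂ (odd , (begin
  (k / 2 + r) % 2                           ≡⟨ cong₂ (λ h s → (h + s) % 2) k/2≡ r≡c+2l ⟩
  (c + 2 * (a + b) + (c + 2 * l)) % 2       ≡⟨ cong (_% 2) (regroup₂ c a b l) ⟩
  (c + a + b + l) * 2 % 2                   ≡⟨ m*n%n≡0 (c + a + b + l) 2 ⟩
  0 ∎))
  where
  open ≡-Reasoning
  regroup₁ : ∀ c a b → 2 * 1 + (4 * 1 * c + 8 * a) + 2 * (4 * b) ≡ 2 * suc ((c + 2 * (a + b)) * 2)
  regroup₁ = solve-∀
  regroup₂ : ∀ c a b l → c + 2 * (a + b) + (c + 2 * l) ≡ (c + a + b + l) * 2
  regroup₂ = solve-∀
  k≡ : k ≡ (c + 2 * (a + b)) * 2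
  k≡ = suc-injective (*-cancelˡ-≡ (suc k) _ 2 (trans count
         (trans (cong (λ e → 2 * e + (4 * e * c + 8 * a) + 2 * (4 * b)) odd) (regroup₁ c a b))))
  k/2≡ : k / 2 ≡ c + 2 * (a + b)
  k/2≡ = trans (cong (_/ 2) k≡) (m*n/n≡m (c + 2 * (a + b)) 2)

module Counting (k : ℕ) (F : Graph k) (simple : IsSimple F) (deg≡2 : ∀ v → degree F v ≡ 2)
  (F-σ : (x y : Vtx k) → F (shiftV (suc k) x) (shiftV (suc k) y) ≡ F x y)
  (covers : (d : Zn k) → toℕ d ≢ 0 → ∃₂ λ (x y : Zn k) → (F (just x) (just y) ≡ true) × (x ⊖ y ≡ d))
  (triangle : compSize F ∞ ≡ 3) where

  open Vertices k
  open TwoRegular k F simple deg≡2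
  open Components k F simple deg≡2
  open ShiftInvariant k F simple deg≡2 F-σ
  open Differences k F simple deg≡2 F-σ covers
  open Residues k
  open TriangleAt∞ k F simple deg≡2 F-σ covers triangle
  open ComponentPairing k F simple deg≡2 F-σ

  crossingComponent : V → ℕ
  crossingComponent = ∑ᶜ crossingDegree

  crossingComponent-σV : ∀ u → crossingComponent (σV u) ≡ crossingComponent u
  crossingComponent-σV = ∑ᶜ-σV crossingDegree crossingDegree-σV

  crossingComponent-connected : ∀ {u u′} → connected F u u′ ≡ true → crossingComponent u ≡ crossingComponent u′
  crossingComponent-connected = ∑ᶜ-connected crossingDegree

  evenComponent : V → ℕ
  evenComponent u = [ isEven (compSize F u) ]· 1

  evenComponent-σV : ∀ u → evenComponent (σV u) ≡ evenComponent u
  evenComponent-σV u = cong (λ m → [ isEven m ]· 1)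
    (trans (compSize≡∑ᶜ (σV u)) (trans (∑ᶜ-σV (λ _ → 1) (λ _ → refl) u) (sym (compSize≡∑ᶜ u))))

  evenComponent-connected : ∀ {u u′} → connected F u u′ ≡ true → evenComponent u ≡ evenComponent u′
  evenComponent-connected {u} {u′} uu′ = cong (λ m → [ isEven m ]· 1)
    (trans (compSize≡∑ᶜ u) (trans (∑ᶜ-connected (λ _ → 1) uu′) (sym (compSize≡∑ᶜ u′))))

  module Crossings = Weighted crossingComponent crossingComponent-σV crossingComponent-connected
  module Evens = Weighted evenComponent evenComponent-σV evenComponent-connected

  fixedReps : ℕ
  fixedReps = sum (λ x → [ fixedRep (just x) ]· 1)

  rep-avoids-∞ : ∀ {x} → isRep F (just x) ≡ true → connected F (just x) ∞ ≢ true
  rep-avoids-∞ rx x↝∞ with isRep⇒rank-≤ rx x↝∞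
  ... | ()

  fixedRep-parts : ∀ {u} → fixedRep u ≡ true → isRep F u ≡ true × connected F u (σV u) ≡ true
  fixedRep-parts {u} ru∧uσu with isRep F u | connected F u (σV u)
  ... | true | true = refl , refl

  fixed-crossings : ∃ λ a → sum (λ x → [ fixedRep (just x) ]· crossingComponent (just x)) ≡ 4 * (n % 2) * fixedReps + 8 * a
  fixed-crossings = sum-affine-mod (4 * (n % 2)) 8 (λ x → [ fixedRep (just x) ]· crossingComponent (just x))
    (λ x → [ fixedRep (just x) ]· 1) pointwise
    where
    pointwise : ∀ x → ∃ λ t → [ fixedRep (just x) ]· crossingComponent (just x) ≡ 4 * (n % 2) * [ fixedRep (just x) ]· 1 + 8 * t
    pointwise x with fixedRep (just x) in fx
    ... | false = 0 , sym (cong (_+ 0) (*-zeroʳ (4 * (n % 2))))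
    ... | true with fixedRep-parts fx
    ...   | rx , xσx with AvoidingCycle.σ-invariant-cycle (just x) (rep-avoids-∞ rx) xσx
    ...     | (t , eq) , _ = t , trans eq (cong (_+ 8 * t) (sym (*-identityʳ (4 * (n % 2)))))

  paired-crossings : ∃ λ b → Crossings.paired ≡ 4 * b
  paired-crossings = sum-multiple 4 (λ i → [ index (vertex i) <ᶠᵇ index (partner (vertex i)) ]· Crossings.onReps (vertex i)) pointwise
    where
    pointwise : ∀ i → ∃ λ t → [ index (vertex i) <ᶠᵇ index (partner (vertex i)) ]· Crossings.onReps (vertex i) ≡ 4 * t
    pointwise zero = 0 , Crossings.paired-∞
    pointwise (suc x) = []·-multiple (index (just x) <ᶠᵇ index (partner (just x))) 4 _ (λ _ → []·-multiple (isRep F (just x)) 4 _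
      (λ rx → AvoidingCycle.∑ᶜ-crossingDegree-4∣ (just x) (rep-avoids-∞ rx)))

  crossing-count : 2 * n ≡ 2 * (n % 2) + (4 * (n % 2) * fixedReps + 8 * proj₁ fixed-crossings) + 2 * (4 * proj₁ paired-crossings)
  crossing-count = begin
    2 * n                                                    ≡⟨ sym ∑-crossingDegree ⟩
    ∑V crossingDegree                                        ≡⟨ ∑V-components crossingDegree ⟩
    ∑V Crossings.onReps                                      ≡⟨ Crossings.∑-reps ⟩
    crossingComponent ∞ + sum (λ x → [ fixedRep (just x) ]· crossingComponent (just x)) + 2 * Crossings.paired
      ≡⟨ cong₂ (λ a f → a + f + 2 * Crossings.paired) ∑ᶜ-crossingDegree-∞ (proj₂ fixed-crossings) ⟩
    2 * (n % 2) + (4 * (n % 2) * fixedReps + 8 * proj₁ fixed-crossings) + 2 * Crossings.paired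
      ≡⟨ cong (λ p → 2 * (n % 2) + (4 * (n % 2) * fixedReps + 8 * proj₁ fixed-crossings) + 2 * p) (proj₂ paired-crossings) ⟩
    2 * (n % 2) + (4 * (n % 2) * fixedReps + 8 * proj₁ fixed-crossings) + 2 * (4 * proj₁ paired-crossings) ∎
    where open ≡-Reasoning

  even-count : evenCycles F ≡ fixedReps + 2 * Evens.paired
  even-count = begin
    evenCycles F                                             ≡⟨ length-filterᵇ-vertices (λ v → isRep F v ∧ isEven (compSize F v)) ⟩
    ∑V (λ v → [ isRep F v ∧ isEven (compSize F v) ]· 1)     ≡⟨ ∑V-cong (λ v → []·-∧ (isRep F v) (isEven (compSize F v)) 1) ⟩
    ∑V Evens.onReps                                          ≡⟨ Evens.∑-reps ⟩
    evenComponent ∞ + sum (λ x → [ fixedRep (just x) ]· evenComponent (just x)) + 2 * Evens.paired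
      ≡⟨ cong₂ (λ e f → e + f + 2 * Evens.paired) (cong (λ m → [ isEven m ]· 1) triangle) (sum-cong-≗ fixed-even) ⟩
    fixedReps + 2 * Evens.paired ∎
    where
    open ≡-Reasoning
    fixed-even : ∀ x → [ fixedRep (just x) ]· evenComponent (just x) ≡ [ fixedRep (just x) ]· 1
    fixed-even x with fixedRep (just x) in fx
    ... | false = refl
    ... | true with fixedRep-parts fx
    ...   | rx , xσx = cong (λ b → [ b ]· 1) (proj₂ (AvoidingCycle.σ-invariant-cycle (just x) (rep-avoids-∞ rx) xσx))

proposition4 : (k : ℕ) (F : Graph k) →
    IsSimple F →
    ((v : Vtx k) → degree F v ≡ 2) →
    ((d : Zn k) → toℕ d ≢ 0 → ∃₂ λ (x y : Zn k) → (F (just x) (just y) ≡ true) × (x ⊖ y ≡ d)) →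
    ((x y : Vtx k) → F (shiftV (suc k) x) (shiftV (suc k) y) ≡ F x y) →
    compSize F ∞ ≡ 3 →
    (suc k % 4 ≡ 0) ⊎ ((suc k % 2 ≡ 1) × ((k / 2 + evenCycles F) % 2 ≡ 0))
proposition4 k F simple deg≡2 covers F-σ triangle =
  parity-count-arithmetic k (evenCycles F) fixedReps (proj₁ fixed-crossings) (proj₁ paired-crossings) Evens.paired
    crossing-count even-count
  where open Counting k F simple deg≡2 F-σ covers triangle
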